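{- Let $\mathbf{M}$ be a nonsingular $n\times n$ integer matrix with $m=|\det\mathbf{M}|=p_1^{r_1}p_2^{r_2}\cdots p_t^{r_t}$ (prime factorization), let $A\subseteq\mathbb{Z}^n/\mathbf{M}\mathbb{Z}^n$, and suppose the multidimensional circulant $G(\mathbf{M};A)$ (on $m$ vertices; digraph, or graph if $A=-A$) has dimension $k$. Then $k\le\max\{r_i:1\le i\le t\}$. In particular, if $m$ is square free, then $G(\mathbf{M};A)$ is a circulant.
   Context: For nonsingular $\mathbf{M}\in\mathbb{Z}^{n\times n}$, $\mathbb{Z}^n/\mathbf{M}\mathbb{Z}^n$ is the quotient of $\mathbb{Z}^n$ by the lattice spanned by the columns of $\mathbf{M}$. For $A\subseteq\mathbb{Z}^n/\mathbf{M}\mathbb{Z}^n$, the multidimensional circulant digraph $G(\mathbf{M};A)$ has vertex set $\mathbb{Z}^n/\mathbf{M}\mathbb{Z}^n$ and arcs $\mathbf{u}\to\mathbf{u}+\mathbf{a}\pmod{\mathbf{M}}$, $\mathbf{a}\in A$; when $A=-A$ it is regarded as a graph. The dimension of such a (di)graph is the smallest $n'$ such that it is isomorphic to a multidimensional circulant $G(\mathbf{M}';A')$ with $\mathbf{M}'$ a nonsingular $n'\times n'$ integer matrix. A circulant is a (di)graph of dimension $1$, i.e. a Cayley (di)graph of a cyclic group $\mathbb{Z}/m\mathbb{Z}$. -}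

module Defs where

open import Level using (0ℓ)
open import Data.Nat as ℕ using (ℕ; zero; suc; _^_; _⊔_; _≤_)
open import Data.Nat.Primality using (Prime)
open import Data.Nat.Divisibility using (_∣_)
open import Data.Integer as ℤ using (ℤ; +_; ∣_∣)
open import Data.Fin using (Fin; zero; suc; toℕ; punchIn)
open import Data.Product using (Σ; ∃; _×_; _,_; proj₁; proj₂)
open import Data.List using (List; map; foldr)
open import Data.Nat.ListAction using (product)
open import Data.List.Relation.Unary.All using (All)
open import Data.List.Relation.Unary.Unique.Propositional using (Unique)
open import Relation.Binary.PropositionalEquality using (_≡_; _≢_)

ℤVec : ℕ → Set
ℤVec n = Fin n → ℤ

Mat : ℕ → Set
Mat n = Fin n → Fin n → ℤ

sumFin : (n : ℕ) → (Fin n → ℤ) → ℤ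
sumFin zero    f = + 0
sumFin (suc n) f = f zero ℤ.+ sumFin n (λ i → f (suc i))

_*ᵥ_ : {n : ℕ} → Mat n → ℤVec n → ℤVec n
_*ᵥ_ {n} M x i = sumFin n (λ j → M i j ℤ.* x j)

_+ᵥ_ : {n : ℕ} → ℤVec n → ℤVec n → ℤVec n
(u +ᵥ v) i = u i ℤ.+ v i

sign : ℕ → ℤ
sign zero = + 1
sign (suc k) = ℤ.- sign k

minor : {n : ℕ} → Mat (suc n) → Fin (suc n) → Mat n
minor M j i l = M (suc i) (punchIn j l)

det : (n : ℕ) → Mat n → ℤ
det zero    M = + 1
det (suc n) M = sumFin (suc n) (λ j → sign (toℕ j) ℤ.* (M zero j ℤ.* det n (minor M j)))

Nonsingular : (n : ℕ) → Mat n → Set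
Nonsingular n M = det n M ≢ + 0

-- Z^n / M Z^n as a setoid on representatives:  u ≈ v  iff  u - v ∈ M Z^n

_≈[_]_ : {n : ℕ} → ℤVec n → Mat n → ℤVec n → Set
u ≈[ M ] v = ∃ λ x → ∀ i → u i ℤ.- v i ≡ (M *ᵥ x) i

-- A subset A of Z^n / M Z^n is given by a predicate on representatives
-- (it denotes the set of classes of the vectors satisfying it).
Subset : ℕ → Set₁
Subset n = ℤVec n → Set

Arc : {n : ℕ} → Mat n → Subset n → ℤVec n → ℤVec n → Set
Arc M A u v = ∃ λ a → A a × (v ≈[ M ] (u +ᵥ a))

record Iso {n n' : ℕ} (M : Mat n) (A : Subset n) (M' : Mat n') (A' : Subset n') : Set where
  field
    to      : ℤVec n → ℤVec n'
    from    : ℤVec n' → ℤVec n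
    to-cong   : ∀ {u v} → u ≈[ M ] v → to u ≈[ M' ] to v
    from-cong : ∀ {u v} → u ≈[ M' ] v → from u ≈[ M ] from v
    from-to : ∀ u → from (to u) ≈[ M ] u
    to-from : ∀ v → to (from v) ≈[ M' ] v
    arc-to   : ∀ u v → Arc M A u v → Arc M' A' (to u) (to v)
    arc-from : ∀ u v → Arc M' A' (to u) (to v) → Arc M A u v

Realisable : {n : ℕ} → Mat n → Subset n → ℕ → Set₁
Realisable M A n' = Σ (Mat n') λ M' → Nonsingular n' M' × Σ (Subset n') λ A' → Iso M A M' A'

HasDimension : {n : ℕ} → Mat n → Subset n → ℕ → Set₁
HasDimension M A k = 1 ≤ k × Realisable M A k × (∀ n' → 1 ≤ n' → Realisable M A n' → k ≤ n')

IsCirculant : {n : ℕ} → Mat n → Subset n → Set₁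
IsCirculant M A = HasDimension M A 1

record PrimeFactorisation (m : ℕ) : Set where
  field
    factors  : List (ℕ × ℕ)
    primes   : All (λ pr → Prime (proj₁ pr)) factors
    exps-pos : All (λ pr → 1 ≤ proj₂ pr) factors
    distinct : Unique (map proj₁ factors)
    product≡ : product (map (λ pr → proj₁ pr ^ proj₂ pr) factors) ≡ m

maxExponent : {m : ℕ} → PrimeFactorisation m → ℕ
maxExponent F = foldr _⊔_ 0 (map proj₂ (PrimeFactorisation.factors F))

SquareFree : ℕ → Set
SquareFree m = ∀ d → d ℕ.* d ∣ m → d ≡ 1

module Submission where

-- Column operations on M leave the lattice M ℤⁿ unchanged and row operations are automorphisms
-- of ℤⁿ carrying M ℤⁿ onto the new lattice, so both give isomorphic circulants and preserve
-- |det M|. Running the Euclidean algorithm on the pivot M₀₀ with these operations produces either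
-- a pivot ±1, whose row and column can then be cleared and deleted, or a pivot g with |g| ≥ 2
-- dividing every entry of an equivalent s × s matrix. In the latter case g^s divides det M, so
-- p^s ∣ m for a prime p ∣ g, whence s ≤ max rᵢ; and the dimension k is at most s.

open import Defs
open import Data.Nat using (ℕ; _≤_)
open import Data.Integer using (∣_∣)
open import Data.Product using (_×_)

module PrimePowers where

  open import Data.Nat using (ℕ; zero; suc; _*_; _^_; _⊔_; _≤_; z≤n; s≤s)
  import Data.Nat.Properties as ℕ
  open import Data.Nat.Divisibility
    using (_∣_; divides; ∣-trans; ∣1⇒≡1; *-cancelˡ-∣; ∣m⇒∣m*n; ∣n⇒∣m*n; *-monoʳ-∣; *-pres-∣; ∣-refl; 1∣_)
  open import Data.Product using (∃; _,_; proj₁; proj₂)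
  open import Data.Sum using (inj₁; inj₂)
  open import Data.Empty using (⊥-elim)
  open import Relation.Nullary using (¬_; yes; no)
  open import Relation.Binary.PropositionalEquality
  open import Function using (_∘_)
  open import Data.Nat.Tactic.RingSolver using (solve-∀)
  open import Data.Nat.Primality using (Prime; euclidsLemma; ¬prime[1]; prime⇒nonZero; prime⇒irreducible)
  open import Data.Nat.Primality.Factorisation using (factorise)
  open import Data.Nat.ListAction using (product)
  open import Data.List using (List; []; _∷_; map; foldr)
  open import Data.List.Relation.Unary.All using (All; []; _∷_)
  open import Data.List.Relation.Unary.AllPairs using ([]; _∷_)
  open import Data.List.Relation.Unary.Unique.Propositional using (Unique)

  prime∤1 : ∀ {p} → Prime p → ¬ p ∣ 1
  prime∤1 p-prime p∣1 = ¬prime[1] (subst Prime (∣1⇒≡1 p∣1) p-prime)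

  prime∤prime^ : ∀ {p q} → Prime p → Prime q → p ≢ q → ∀ r → ¬ p ∣ q ^ r
  prime∤prime^ p-prime q-prime p≢q zero = prime∤1 p-prime
  prime∤prime^ {p} {q} p-prime q-prime p≢q (suc r) p∣q^[1+r] with euclidsLemma q (q ^ r) p-prime p∣q^[1+r]
  ... | inj₂ p∣q^r = prime∤prime^ p-prime q-prime p≢q r p∣q^r
  ... | inj₁ p∣q with prime⇒irreducible q-prime p∣q
  ...   | inj₁ p≡1 = ¬prime[1] (subst Prime p≡1 p-prime)
  ...   | inj₂ p≡q = p≢q p≡q

  primePower : ℕ × ℕ → ℕ
  primePower (q , r) = q ^ r

  prime∤product : ∀ {p} → Prime p → ∀ L → All (Prime ∘ proj₁) L → All (p ≢_) (map proj₁ L) →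
    ¬ p ∣ product (map primePower L)
  prime∤product p-prime []            _                  _              = prime∤1 p-prime
  prime∤product p-prime ((q , r) ∷ L) (q-prime ∷ primes) (p≢q ∷ p≢qs) p∣∏
    with euclidsLemma (q ^ r) (product (map primePower L)) p-prime p∣∏
  ... | inj₁ p∣q^r = prime∤prime^ p-prime q-prime p≢q r p∣q^r
  ... | inj₂ p∣∏L  = prime∤product p-prime L primes p≢qs p∣∏L

  prime^∣-cancelˡ : ∀ {p a} → Prime p → ¬ p ∣ a → ∀ s x → p ^ s ∣ a * x → p ^ s ∣ x
  prime^∣-cancelˡ p-prime p∤a zero x _ = 1∣ x
  prime^∣-cancelˡ {p} {a} p-prime p∤a (suc s) x p^[1+s]∣ax
    with euclidsLemma a x p-prime (∣-trans (∣m⇒∣m*n (p ^ s) ∣-refl) p^[1+s]∣ax)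
  ... | inj₁ p∣a = ⊥-elim (p∤a p∣a)
  ... | inj₂ (divides x' x≡x'p) =
    subst (p ^ suc s ∣_) (trans (ℕ.*-comm p x') (sym x≡x'p)) (*-monoʳ-∣ p p^s∣x')
    where
    instance _ = prime⇒nonZero p-prime
    p^s∣x' : p ^ s ∣ x'
    p^s∣x' = prime^∣-cancelˡ p-prime p∤a s x'
      (*-cancelˡ-∣ p (subst (p ^ suc s ∣_) (trans (cong (a *_) x≡x'p) (rearrange a x' p)) p^[1+s]∣ax))
      where
      rearrange : ∀ a x' p → a * (x' * p) ≡ p * (a * x')
      rearrange = solve-∀

  prime^∣prime^*⇒≤ : ∀ {p x} → Prime p → ¬ p ∣ x → ∀ s r → p ^ s ∣ p ^ r * x → s ≤ r
  prime^∣prime^*⇒≤ p-prime p∤x zero r _ = z≤n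
  prime^∣prime^*⇒≤ {p} {x} p-prime p∤x (suc s) zero p^[1+s]∣x =
    ⊥-elim (p∤x (∣-trans (∣m⇒∣m*n (p ^ s) ∣-refl) (subst (p ^ suc s ∣_) (ℕ.*-identityˡ x) p^[1+s]∣x)))
  prime^∣prime^*⇒≤ {p} {x} p-prime p∤x (suc s) (suc r) p^[1+s]∣p^[1+r]x =
    s≤s (prime^∣prime^*⇒≤ p-prime p∤x s r (*-cancelˡ-∣ p (subst (p ^ suc s ∣_) (ℕ.*-assoc p (p ^ r) x) p^[1+s]∣p^[1+r]x)))
    where instance _ = prime⇒nonZero p-prime

  prime^∣⇒≤maxExponent : ∀ {m} (F : PrimeFactorisation m) {p} → Prime p → ∀ s → p ^ s ∣ m → s ≤ maxExponent F
  prime^∣⇒≤maxExponent {m} F {p} p-prime s p^s∣m = go factors primes distinct (subst (p ^ s ∣_) (sym product≡) p^s∣m)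
    where
    open PrimeFactorisation F
    go : ∀ L → All (Prime ∘ proj₁) L → Unique (map proj₁ L) →
      p ^ s ∣ product (map primePower L) → s ≤ foldr _⊔_ 0 (map proj₂ L)
    go [] _ _ p^s∣1 = prime^∣prime^*⇒≤ p-prime (prime∤1 p-prime) s 0 p^s∣1
    go ((q , r) ∷ L) (q-prime ∷ primes) (q∉L ∷ unique) p^s∣∏ with p ℕ.≟ q
    ... | yes refl = ℕ.≤-trans (prime^∣prime^*⇒≤ p-prime (prime∤product p-prime L primes q∉L) s r p^s∣∏) (ℕ.m≤m⊔n r _)
    ... | no p≢q   = ℕ.≤-trans (go L primes unique (prime^∣-cancelˡ p-prime (prime∤prime^ p-prime q-prime p≢q r) s _ p^s∣∏))
                               (ℕ.m≤n⊔m r _)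

  squareFree⇒maxExponent≤1 : ∀ {m} (F : PrimeFactorisation m) → SquareFree m → maxExponent F ≤ 1
  squareFree⇒maxExponent≤1 {m} F squareFree = go factors primes (subst SquareFree (sym product≡) squareFree)
    where
    open PrimeFactorisation F
    go : ∀ L → All (Prime ∘ proj₁) L → (∀ d → d * d ∣ product (map primePower L) → d ≡ 1) →
      foldr _⊔_ 0 (map proj₂ L) ≤ 1
    go [] _ _ = z≤n
    go ((q , r) ∷ L) (q-prime ∷ primes) sf =
      ℕ.⊔-lub (exponent≤1 r (∣m⇒∣m*n _ ∣-refl))
              (go L primes (λ d d²∣ → sf d (∣-trans d²∣ (∣n⇒∣m*n (q ^ r) ∣-refl))))
      where
      exponent≤1 : ∀ t → q ^ t ∣ product (map primePower ((q , r) ∷ L)) → t ≤ 1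
      exponent≤1 zero                _     = z≤n
      exponent≤1 (suc zero)          _     = s≤s z≤n
      exponent≤1 (suc (suc t)) q^[2+t]∣∏ =
        ⊥-elim (¬prime[1] (subst Prime (sf q (∣-trans (*-monoʳ-∣ q (∣m⇒∣m*n (q ^ t) ∣-refl)) q^[2+t]∣∏)) q-prime))

  ^-monoˡ-∣ : ∀ {p a} s → p ∣ a → p ^ s ∣ a ^ s
  ^-monoˡ-∣ zero    _   = ∣-refl
  ^-monoˡ-∣ (suc s) p∣a = *-pres-∣ p∣a (^-monoˡ-∣ s p∣a)

  ∃prime∣ : ∀ {g} → 2 ≤ g → ∃ λ p → Prime p × p ∣ g
  ∃prime∣ {suc g} 2≤g with factorise (suc g)
  ... | record { factors = [] ; isFactorisation = g≡∏ } = ⊥-elim (ℕ.<⇒≢ 2≤g (sym g≡∏))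
  ... | record { factors = p ∷ ps ; isFactorisation = g≡∏ ; factorsPrime = p-prime ∷ _ } =
    p , p-prime , divides (product ps) (trans g≡∏ (ℕ.*-comm p (product ps)))

open PrimePowers

open import Data.Nat as ℕ using (zero; suc; z≤n; s≤s)
import Data.Nat.Properties as ℕ
import Data.Nat.Divisibility as ℕ
open import Data.Nat.Primality using (Prime)
open import Data.Integer as ℤ using (ℤ; +_; _+_; _*_; -_; _-_)
open import Data.Integer.Properties as ℤ using (+-*-semiring)
open import Data.Integer.Tactic.RingSolver using (solve-∀)
open import Data.Integer.DivMod using (_/_; _%_; a≡a%n+[a/n]*n; n%d<d)
open import Data.Integer.Base using (≢-nonZero)
open import Data.Integer.Divisibility.Signed
  using (_∣_; divides; _∣?_; ∣-refl; ∣m∣n⇒∣m+n; ∣m+n∣m⇒∣n; ∣m+n∣n⇒∣m; ∣n⇒∣m*n; ∣⇒∣ᵤ)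
open import Data.Fin using (Fin; zero; suc; toℕ; punchIn; punchOut; inject₁; _≟_)
open import Data.Fin.Properties
  using (all?; ¬∀⟶∃¬; punchIn-punchOut; punchInᵢ≢i; punchIn-injective; suc-injective; toℕ-inject₁; toℕ-injective)
open import Data.Vec.Functional using (updateAt; transpose; tail) renaming (_∷_ to _∷ᵥ_)
open import Data.Vec.Functional.Properties using (updateAt-updates; updateAt-minimal)
open import Algebra.Properties.Semiring.Sum +-*-semiring
  using (sum; sum-cong-≗; ∑-distrib-+; ∑-comm; sum-remove; *-distribˡ-sum; sum-replicate-zero)
open import Data.Product using (∃; _,_; proj₁; proj₂)
open import Data.Sum using (_⊎_; inj₁; inj₂)
open import Data.Empty using (⊥-elim)
open import Relation.Nullary using (¬_; yes; no)
open import Relation.Binary.Definitions using (tri<; tri≈; tri>)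
open import Relation.Binary.PropositionalEquality
open import Function using (_∘_; const)
open import Data.List using (List; []; _∷_; allFin)
open import Data.List.Membership.Propositional using (_∈_)
open import Data.List.Membership.Propositional.Properties using (∈-allFin)
open import Data.List.Relation.Unary.Any using (here; there)
open import Induction.WellFounded using (Acc; acc)
open import Data.Nat.Induction using (<-wellFounded)
open import Level using (0ℓ)
open import Relation.Binary.Bundles using (Setoid)
import Relation.Binary.Reasoning.MultiSetoid as MultiSetoid

sumFin≡sum : ∀ n (f : Fin n → ℤ) → sumFin n f ≡ sum f
sumFin≡sum zero    f = refl
sumFin≡sum (suc n) f = cong (_+_ (f zero)) (sumFin≡sum n (f ∘ suc))

sumFin-cong : ∀ n {f g : Fin n → ℤ} → f ≗ g → sumFin n f ≡ sumFin n g
sumFin-cong n {f} {g} f≗g rewrite sumFin≡sum n f | sumFin≡sum n g = sum-cong-≗ f≗g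

sumFin-distrib-+ : ∀ n (f g : Fin n → ℤ) → sumFin n (λ i → f i + g i) ≡ sumFin n f + sumFin n g
sumFin-distrib-+ n f g
  rewrite sumFin≡sum n (λ i → f i + g i) | sumFin≡sum n f | sumFin≡sum n g = ∑-distrib-+ f g

*-distribˡ-sumFin : ∀ n c (f : Fin n → ℤ) → c * sumFin n f ≡ sumFin n (λ i → c * f i)
*-distribˡ-sumFin n c f rewrite sumFin≡sum n f | sumFin≡sum n (λ i → c * f i) = *-distribˡ-sum c f

sumFin-comm : ∀ m n (f : Fin m → Fin n → ℤ) →
  sumFin m (λ i → sumFin n (f i)) ≡ sumFin n (λ j → sumFin m (λ i → f i j))
sumFin-comm m n f = begin
  sumFin m (λ i → sumFin n (f i))        ≡⟨ sumFin-cong m (λ i → sumFin≡sum n (f i)) ⟩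
  sumFin m (λ i → sum (f i))             ≡⟨ sumFin≡sum m _ ⟩
  sum (λ i → sum (f i))                  ≡⟨ ∑-comm f ⟩
  sum (λ j → sum (λ i → f i j))          ≡⟨ sumFin≡sum n _ ⟨
  sumFin n (λ j → sum (λ i → f i j))     ≡⟨ sumFin-cong n (λ j → sumFin≡sum m (λ i → f i j)) ⟨
  sumFin n (λ j → sumFin m (λ i → f i j)) ∎
  where open ≡-Reasoning

sumFin-zero : ∀ n {f : Fin n → ℤ} → (∀ i → f i ≡ + 0) → sumFin n f ≡ + 0
sumFin-zero n {f} f≗0 = trans (sumFin-cong n f≗0) (trans (sumFin≡sum n _) (sum-replicate-zero n))

sumFin-single : ∀ n (f : Fin n → ℤ) j → (∀ i → i ≢ j → f i ≡ + 0) → sumFin n f ≡ f j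
sumFin-single (suc n) f j f≗0 = begin
  sumFin (suc n) f                     ≡⟨ sumFin≡sum (suc n) f ⟩
  sum f                                ≡⟨ sum-remove {i = j} f ⟩
  f j + sum (f ∘ punchIn j)            ≡⟨ cong (_+_ (f j)) (sumFin≡sum n (f ∘ punchIn j)) ⟨
  f j + sumFin n (f ∘ punchIn j)       ≡⟨ cong (_+_ (f j)) (sumFin-zero n (λ k → f≗0 _ (punchInᵢ≢i j k))) ⟩
  f j + + 0                            ≡⟨ ℤ.+-identityʳ (f j) ⟩
  f j                                  ∎
  where open ≡-Reasoning

sumFin-pair : ∀ n (f : Fin n → ℤ) {a b} → a ≢ b → (∀ i → i ≢ a → i ≢ b → f i ≡ + 0) →
  sumFin n f ≡ f a + f b
sumFin-pair (suc n) f {a} {b} a≢b f≗0 = begin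
  sumFin (suc n) f                   ≡⟨ sumFin≡sum (suc n) f ⟩
  sum f                              ≡⟨ sum-remove {i = a} f ⟩
  f a + sum (f ∘ punchIn a)          ≡⟨ cong (_+_ (f a)) (sumFin≡sum n (f ∘ punchIn a)) ⟨
  f a + sumFin n (f ∘ punchIn a)     ≡⟨ cong (_+_ (f a)) (sumFin-single n _ (punchOut a≢b) rest≗0) ⟩
  f a + f (punchIn a (punchOut a≢b)) ≡⟨ cong (λ k → f a + f k) (punchIn-punchOut a≢b) ⟩
  f a + f b                          ∎
  where
  open ≡-Reasoning
  rest≗0 : ∀ k → k ≢ punchOut a≢b → f (punchIn a k) ≡ + 0
  rest≗0 k k≢ = f≗0 _ (punchInᵢ≢i a k)
    (λ e → k≢ (punchIn-injective a k _ (trans e (sym (punchIn-punchOut a≢b)))))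

sumFin-differAt : ∀ n (f g : Fin n → ℤ) j → (∀ l → l ≢ j → f l ≡ g l) →
  sumFin n f ≡ sumFin n g + (f j - g j)
sumFin-differAt n f g j f≗g = begin
  sumFin n f                                 ≡⟨ sumFin-cong n (λ l → split (f l) (g l)) ⟩
  sumFin n (λ l → g l + (f l - g l))         ≡⟨ sumFin-distrib-+ n g (λ l → f l - g l) ⟩
  sumFin n g + sumFin n (λ l → f l - g l)    ≡⟨ cong (_+_ (sumFin n g)) (sumFin-single n _ j differ) ⟩
  sumFin n g + (f j - g j)                   ∎
  where
  open ≡-Reasoning
  split : ∀ a b → a ≡ b + (a - b)
  split = solve-∀
  differ : ∀ l → l ≢ j → f l - g l ≡ + 0
  differ l l≢j = trans (cong (_- g l) (f≗g l l≢j)) (ℤ.+-inverseʳ (g l))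

updateAt-≗ : ∀ {n} (xs : ℤVec n) j {f} {v : ℤVec n} →
  f (xs j) ≡ v j → (∀ l → l ≢ j → xs l ≡ v l) → updateAt xs j f ≗ v
updateAt-≗ xs j at off l with l ≟ j
... | yes refl = trans (updateAt-updates l xs) at
... | no l≢j   = trans (updateAt-minimal l j xs l≢j) (off l l≢j)

_-ᵥ_ : ∀ {n} → ℤVec n → ℤVec n → ℤVec n
(u -ᵥ v) i = u i - v i

shear : ∀ {n} → Fin n → Fin n → ℤ → ℤVec n → ℤVec n
shear j i c x = updateAt x j (λ t → t + c * x i)

shear-at : ∀ {n} j i c (x : ℤVec n) → shear j i c x j ≡ x j + c * x i
shear-at j i c x = updateAt-updates j x

shear-off : ∀ {n} {j} i c (x : ℤVec n) {l} → l ≢ j → shear j i c x l ≡ x l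
shear-off {j = j} i c x l≢j = updateAt-minimal _ j x l≢j

module _ {n} (j i : Fin n) (c : ℤ) where

  shear-cong : ∀ {x y} → x ≗ y → shear j i c x ≗ shear j i c y
  shear-cong {x} {y} x≗y = updateAt-≗ x j
    (trans (cong₂ (λ a b → a + c * b) (x≗y j) (x≗y i)) (sym (shear-at j i c y)))
    (λ l l≢j → trans (x≗y l) (sym (shear-off i c y l≢j)))

  shear-+ᵥ : ∀ x y → shear j i c (x +ᵥ y) ≗ shear j i c x +ᵥ shear j i c y
  shear-+ᵥ x y = updateAt-≗ (x +ᵥ y) j
    (trans (expand (x j) (y j) (x i) (y i) c) (sym (cong₂ _+_ (shear-at j i c x) (shear-at j i c y))))
    (λ l l≢j → sym (cong₂ _+_ (shear-off i c x l≢j) (shear-off i c y l≢j)))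
    where
    expand : ∀ a b p q c → (a + b) + c * (p + q) ≡ (a + c * p) + (b + c * q)
    expand = solve-∀

  shear-minusᵥ : ∀ x y → shear j i c x -ᵥ shear j i c y ≗ shear j i c (x -ᵥ y)
  shear-minusᵥ x y = sym ∘ updateAt-≗ (x -ᵥ y) j
    (trans (expand (x j) (y j) (x i) (y i) c) (sym (cong₂ _-_ (shear-at j i c x) (shear-at j i c y))))
    (λ l l≢j → sym (cong₂ _-_ (shear-off i c x l≢j) (shear-off i c y l≢j)))
    where
    expand : ∀ a b p q c → (a - b) + c * (p - q) ≡ (a + c * p) - (b + c * q)
    expand = solve-∀

  shear-inverse : i ≢ j → ∀ {c'} → c + c' ≡ + 0 → ∀ x → shear j i c' (shear j i c x) ≗ x
  shear-inverse i≢j {c'} c+c'≡0 x = updateAt-≗ _ j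
    (begin
      shear j i c x j + c' * shear j i c x i  ≡⟨ cong₂ (λ a b → a + c' * b) (shear-at j i c x) (shear-off i c x i≢j) ⟩
      (x j + c * x i) + c' * x i              ≡⟨ regroup (x j) (x i) c c' ⟩
      x j + (c + c') * x i                    ≡⟨ cong (λ s → x j + s * x i) c+c'≡0 ⟩
      x j + + 0 * x i                         ≡⟨ vanish (x j) (x i) ⟩
      x j                                     ∎)
    (λ l l≢j → shear-off i c x l≢j)
    where
    open ≡-Reasoning
    regroup : ∀ a b c c' → (a + c * b) + c' * b ≡ a + (c + c') * b
    regroup = solve-∀
    vanish : ∀ a b → a + + 0 * b ≡ a
    vanish = solve-∀

setCol : ∀ {n} → Mat n → Fin n → ℤVec n → Mat n
setCol M j v r = updateAt (M r) j (const (v r))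

addCol : ∀ {n} → Mat n → Fin n → Fin n → ℤ → Mat n
addCol M j i c r = shear j i c (M r)

addRow : ∀ {n} → Mat n → Fin n → Fin n → ℤ → Mat n
addRow M j i c = transpose (addCol (transpose M) j i c)

*ᵥ-cong : ∀ {n} (M : Mat n) {x y} → x ≗ y → M *ᵥ x ≗ M *ᵥ y
*ᵥ-cong {n} M x≗y r = sumFin-cong n (λ l → cong (M r l *_) (x≗y l))

*ᵥ-+ᵥ : ∀ {n} (M : Mat n) x y → M *ᵥ (x +ᵥ y) ≗ (M *ᵥ x) +ᵥ (M *ᵥ y)
*ᵥ-+ᵥ {n} M x y r = trans (sumFin-cong n (λ l → ℤ.*-distribˡ-+ (M r l) (x l) (y l)))
                          (sumFin-distrib-+ n (λ l → M r l * x l) (λ l → M r l * y l))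

*ᵥ-neg : ∀ {n} (M : Mat n) x → M *ᵥ (-_ ∘ x) ≗ -_ ∘ (M *ᵥ x)
*ᵥ-neg {n} M x r = begin
  sumFin n (λ l → M r l * - x l)        ≡⟨ sumFin-cong n (λ l → pull (M r l) (x l)) ⟩
  sumFin n (λ l → - + 1 * (M r l * x l)) ≡⟨ *-distribˡ-sumFin n (- + 1) _ ⟨
  - + 1 * sumFin n (λ l → M r l * x l)   ≡⟨ ℤ.-1*i≡-i _ ⟩
  - sumFin n (λ l → M r l * x l)         ∎
  where
  open ≡-Reasoning
  pull : ∀ a b → a * - b ≡ - + 1 * (a * b)
  pull = solve-∀

*ᵥ-zero : ∀ {n} (M : Mat n) → M *ᵥ const (+ 0) ≗ const (+ 0)
*ᵥ-zero {n} M r = sumFin-zero n (λ l → ℤ.*-zeroʳ (M r l))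

addCol-*ᵥ : ∀ {n} (M : Mat n) j i c x → addCol M j i c *ᵥ x ≗ M *ᵥ shear i j c x
addCol-*ᵥ {n} M j i c x r = begin
  sumFin n (λ l → addCol M j i c r l * x l)
    ≡⟨ sumFin-differAt n _ (λ l → M r l * x l) j (λ l l≢j → cong (_* x l) (shear-off i c (M r) l≢j)) ⟩
  (M *ᵥ x) r + (addCol M j i c r j * x j - M r j * x j)
    ≡⟨ cong (λ a → (M *ᵥ x) r + (a * x j - M r j * x j)) (shear-at j i c (M r)) ⟩
  (M *ᵥ x) r + ((M r j + c * M r i) * x j - M r j * x j)
    ≡⟨ cong (_+_ ((M *ᵥ x) r)) (move (M r j) (M r i) c (x j) (x i)) ⟩
  (M *ᵥ x) r + (M r i * (x i + c * x j) - M r i * x i)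
    ≡⟨ cong (λ a → (M *ᵥ x) r + (M r i * a - M r i * x i)) (shear-at i j c x) ⟨
  (M *ᵥ x) r + (M r i * shear i j c x i - M r i * x i)
    ≡⟨ sumFin-differAt n _ (λ l → M r l * x l) i (λ l l≢i → cong (M r l *_) (shear-off j c x l≢i)) ⟨
  sumFin n (λ l → M r l * shear i j c x l) ∎
  where
  open ≡-Reasoning
  move : ∀ a b c y z → (a + c * b) * y - a * y ≡ b * (z + c * y) - b * z
  move = solve-∀

addRow-*ᵥ : ∀ {n} (M : Mat n) j i c x → addRow M j i c *ᵥ x ≗ shear j i c (M *ᵥ x)
addRow-*ᵥ {n} M j i c x = sym ∘ updateAt-≗ (M *ᵥ x) j at off
  where
  open ≡-Reasoning
  at : (M *ᵥ x) j + c * (M *ᵥ x) i ≡ (addRow M j i c *ᵥ x) j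
  at = begin
    (M *ᵥ x) j + c * (M *ᵥ x) i
      ≡⟨ cong (_+_ ((M *ᵥ x) j)) (*-distribˡ-sumFin n c _) ⟩
    (M *ᵥ x) j + sumFin n (λ l → c * (M i l * x l))
      ≡⟨ sumFin-distrib-+ n _ _ ⟨
    sumFin n (λ l → M j l * x l + c * (M i l * x l))
      ≡⟨ sumFin-cong n (λ l → trans (distrib (M j l) (M i l) c (x l)) (cong (_* x l) (sym (shear-at j i c (λ r → M r l))))) ⟩
    (addRow M j i c *ᵥ x) j ∎
    where
    distrib : ∀ a b c y → a * y + c * (b * y) ≡ (a + c * b) * y
    distrib = solve-∀
  off : ∀ r → r ≢ j → (M *ᵥ x) r ≡ (addRow M j i c *ᵥ x) r
  off r r≢j = sumFin-cong n (λ l → cong (_* x l) (sym (shear-off i c (λ r' → M r' l) r≢j)))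

det-cong : ∀ n {M M' : Mat n} → (∀ i j → M i j ≡ M' i j) → det n M ≡ det n M'
det-cong zero    M≗M' = refl
det-cong (suc n) M≗M' = sumFin-cong (suc n) (λ j →
  cong₂ (λ a d → sign (toℕ j) * (a * d)) (M≗M' zero j) (det-cong n (λ i l → M≗M' (suc i) (punchIn j l))))

expansionTerm : ∀ {n} → Mat (suc n) → Fin (suc n) → ℤ
expansionTerm {n} M j = sign (toℕ j) * (M zero j * det n (minor M j))

punchIn≢ : ∀ {n} {j c : Fin (suc n)} (j≢c : j ≢ c) l → l ≢ punchOut j≢c → punchIn j l ≢ c
punchIn≢ {j = j} j≢c l l≢ e = l≢ (punchIn-injective j l _ (trans e (sym (punchIn-punchOut j≢c))))

det-linearInCol : ∀ n {M M₁ M₂ : Mat n} c a b →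
  (∀ i j → j ≢ c → M i j ≡ M₁ i j) → (∀ i j → j ≢ c → M i j ≡ M₂ i j) →
  (∀ i → M i c ≡ a * M₁ i c + b * M₂ i c) → det n M ≡ a * det n M₁ + b * det n M₂
det-linearInCol (suc n) {M} {M₁} {M₂} c a b same₁ same₂ col = begin
  sumFin (suc n) (expansionTerm M)
    ≡⟨ sumFin-cong (suc n) term ⟩
  sumFin (suc n) (λ j → a * expansionTerm M₁ j + b * expansionTerm M₂ j)
    ≡⟨ sumFin-distrib-+ (suc n) (λ j → a * expansionTerm M₁ j) (λ j → b * expansionTerm M₂ j) ⟩
  sumFin (suc n) (λ j → a * expansionTerm M₁ j) + sumFin (suc n) (λ j → b * expansionTerm M₂ j)
    ≡⟨ cong₂ _+_ (*-distribˡ-sumFin (suc n) a (expansionTerm M₁)) (*-distribˡ-sumFin (suc n) b (expansionTerm M₂)) ⟨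
  a * det (suc n) M₁ + b * det (suc n) M₂ ∎
  where
  open ≡-Reasoning
  linearEntry : ∀ s m m₁ m₂ d → m ≡ a * m₁ + b * m₂ →
    s * (m * d) ≡ a * (s * (m₁ * d)) + b * (s * (m₂ * d))
  linearEntry s m m₁ m₂ d refl = ring s m₁ m₂ a b d
    where
    ring : ∀ s x y a b d → s * ((a * x + b * y) * d) ≡ a * (s * (x * d)) + b * (s * (y * d))
    ring = solve-∀
  linearMinor : ∀ s m d d₁ d₂ → d ≡ a * d₁ + b * d₂ →
    s * (m * d) ≡ a * (s * (m * d₁)) + b * (s * (m * d₂))
  linearMinor s m d d₁ d₂ refl = ring s m a b d₁ d₂
    where
    ring : ∀ s m a b d₁ d₂ → s * (m * (a * d₁ + b * d₂)) ≡ a * (s * (m * d₁)) + b * (s * (m * d₂))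
    ring = solve-∀
  term : ∀ j → expansionTerm M j ≡ a * expansionTerm M₁ j + b * expansionTerm M₂ j
  term j with j ≟ c
  ... | yes refl = begin
    sign (toℕ j) * (M zero j * det n (minor M j))
      ≡⟨ linearEntry (sign (toℕ j)) _ (M₁ zero j) (M₂ zero j) (det n (minor M j)) (col zero) ⟩
    a * (sign (toℕ j) * (M₁ zero j * det n (minor M j))) + b * (sign (toℕ j) * (M₂ zero j * det n (minor M j)))
      ≡⟨ cong₂ (λ d₁ d₂ → a * (sign (toℕ j) * (M₁ zero j * d₁)) + b * (sign (toℕ j) * (M₂ zero j * d₂)))
               (det-cong n (λ i l → same₁ (suc i) (punchIn j l) (punchInᵢ≢i j l)))
               (det-cong n (λ i l → same₂ (suc i) (punchIn j l) (punchInᵢ≢i j l))) ⟩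
    a * expansionTerm M₁ j + b * expansionTerm M₂ j ∎
  ... | no j≢c = begin
    sign (toℕ j) * (M zero j * det n (minor M j))
      ≡⟨ linearMinor (sign (toℕ j)) (M zero j) _ (det n (minor M₁ j)) (det n (minor M₂ j))
           (det-linearInCol n (punchOut j≢c) a b
              (λ i l l≢ → same₁ (suc i) (punchIn j l) (punchIn≢ j≢c l l≢))
              (λ i l l≢ → same₂ (suc i) (punchIn j l) (punchIn≢ j≢c l l≢))
              (λ i → subst (λ k → M (suc i) k ≡ a * M₁ (suc i) k + b * M₂ (suc i) k)
                           (sym (punchIn-punchOut j≢c)) (col (suc i)))) ⟩
    a * (sign (toℕ j) * (M zero j * det n (minor M₁ j))) + b * (sign (toℕ j) * (M zero j * det n (minor M₂ j)))
      ≡⟨ cong₂ (λ m₁ m₂ → a * (sign (toℕ j) * (m₁ * det n (minor M₁ j))) + b * (sign (toℕ j) * (m₂ * det n (minor M₂ j))))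
               (same₁ zero j j≢c) (same₂ zero j j≢c) ⟩
    a * expansionTerm M₁ j + b * expansionTerm M₂ j ∎

inject₁≢suc : ∀ {n} (c : Fin n) → inject₁ c ≢ suc c
inject₁≢suc c e = ℕ.1+n≢n (sym (trans (sym (toℕ-inject₁ c)) (cong toℕ e)))

punchIn-adjacent : ∀ {n} (c l : Fin n) →
  punchIn (inject₁ c) l ≡ punchIn (suc c) l ⊎ (punchIn (inject₁ c) l ≡ suc c × punchIn (suc c) l ≡ inject₁ c)
punchIn-adjacent zero    zero    = inj₂ (refl , refl)
punchIn-adjacent zero    (suc l) = inj₁ refl
punchIn-adjacent (suc c) zero    = inj₁ refl
punchIn-adjacent (suc c) (suc l) with punchIn-adjacent c l
... | inj₁ e          = inj₁ (cong suc e)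
... | inj₂ (e₁ , e₂) = inj₂ (cong suc e₁ , cong suc e₂)

punchOut-adjacent : ∀ {n} (c : Fin (suc n)) j (j≢c : j ≢ inject₁ c) (j≢c+1 : j ≢ suc c) →
  ∃ λ c' → punchOut j≢c ≡ inject₁ c' × punchOut j≢c+1 ≡ suc c'
punchOut-adjacent zero zero j≢c _ = ⊥-elim (j≢c refl)
punchOut-adjacent zero (suc zero) _ j≢c+1 = ⊥-elim (j≢c+1 refl)
punchOut-adjacent {suc n} zero (suc (suc j)) _ _ = zero , refl , refl
punchOut-adjacent {suc n} (suc c) zero _ _ = c , refl , refl
punchOut-adjacent {suc n} (suc c) (suc j) j≢c j≢c+1
  with punchOut-adjacent c j (j≢c ∘ cong suc) (j≢c+1 ∘ cong suc)
... | c' , e₁ , e₂ = suc c' , cong suc e₁ , cong suc e₂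

det-equalAdjacentCols : ∀ n (M : Mat (suc n)) c → (∀ i → M i (inject₁ c) ≡ M i (suc c)) → det (suc n) M ≡ + 0
det-equalAdjacentCols (suc n) M c cols≡ = begin
  sumFin (suc (suc n)) (expansionTerm M)
    ≡⟨ sumFin-pair (suc (suc n)) (expansionTerm M) (inject₁≢suc c) vanishes ⟩
  expansionTerm M (inject₁ c) + expansionTerm M (suc c)
    ≡⟨ cong₂ (λ s' m' → s' * (m * D) + - s * (m' * D')) (cong sign (toℕ-inject₁ c)) (sym (cols≡ zero)) ⟩
  s * (m * D) + - s * (m * D')
    ≡⟨ cong (λ d → s * (m * D) + - s * (m * d)) (det-cong (suc n) minors≡) ⟨
  s * (m * D) + - s * (m * D)
    ≡⟨ cancel s m D ⟩
  + 0 ∎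
  where
  open ≡-Reasoning
  s = sign (toℕ c)
  m = M zero (inject₁ c)
  D = det (suc n) (minor M (inject₁ c))
  D' = det (suc n) (minor M (suc c))
  cancel : ∀ s m d → s * (m * d) + - s * (m * d) ≡ + 0
  cancel = solve-∀
  minors≡ : ∀ i l → minor M (inject₁ c) i l ≡ minor M (suc c) i l
  minors≡ i l with punchIn-adjacent c l
  ... | inj₁ e          = cong (M (suc i)) e
  ... | inj₂ (e₁ , e₂) = trans (cong (M (suc i)) e₁) (trans (sym (cols≡ (suc i))) (cong (M (suc i)) (sym e₂)))
  vanishes : ∀ j → j ≢ inject₁ c → j ≢ suc c → expansionTerm M j ≡ + 0
  vanishes j j≢c j≢c+1 with punchOut-adjacent c j j≢c j≢c+1
  ... | c' , e₁ , e₂ = trans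
    (cong (λ d → sign (toℕ j) * (M zero j * d))
      (det-equalAdjacentCols n (minor M j) c' (λ i → begin
        M (suc i) (punchIn j (inject₁ c'))     ≡⟨ cong (M (suc i) ∘ punchIn j) e₁ ⟨
        M (suc i) (punchIn j (punchOut j≢c))   ≡⟨ cong (M (suc i)) (punchIn-punchOut j≢c) ⟩
        M (suc i) (inject₁ c)                  ≡⟨ cols≡ (suc i) ⟩
        M (suc i) (suc c)                      ≡⟨ cong (M (suc i)) (punchIn-punchOut j≢c+1) ⟨
        M (suc i) (punchIn j (punchOut j≢c+1)) ≡⟨ cong (M (suc i) ∘ punchIn j) e₂ ⟩
        M (suc i) (punchIn j (suc c'))         ∎)))
    (zero-factor (sign (toℕ j)) (M zero j))
    where
    zero-factor : ∀ s m → s * (m * + 0) ≡ + 0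
    zero-factor = solve-∀

det-additiveInCol : ∀ n {M M₁ M₂ : Mat n} c →
  (∀ i j → j ≢ c → M i j ≡ M₁ i j) → (∀ i j → j ≢ c → M i j ≡ M₂ i j) →
  (∀ i → M i c ≡ M₁ i c + M₂ i c) → det n M ≡ det n M₁ + det n M₂
det-additiveInCol n {M} {M₁} {M₂} c same₁ same₂ col =
  trans (det-linearInCol n c (+ 1) (+ 1) same₁ same₂
          (λ i → trans (col i) (cong₂ _+_ (sym (ℤ.*-identityˡ (M₁ i c))) (sym (ℤ.*-identityˡ (M₂ i c))))))
        (cong₂ _+_ (ℤ.*-identityˡ (det n M₁)) (ℤ.*-identityˡ (det n M₂)))

setCol-at : ∀ {n} (M : Mat n) j v i → setCol M j v i j ≡ v i
setCol-at M j v i = updateAt-updates j (M i)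

setCol-off : ∀ {n} (M : Mat n) {j} v i {l} → l ≢ j → setCol M j v i l ≡ M i l
setCol-off M {j} v i l≢j = updateAt-minimal _ j (M i) l≢j

module TwoColumns {n} (M : Mat n) {a b : Fin n} (a≢b : a ≢ b) where

  setCols : ℤVec n → ℤVec n → Mat n
  setCols u v = setCol (setCol M a u) b v

  setCols-a : ∀ u v i → setCols u v i a ≡ u i
  setCols-a u v i = trans (setCol-off (setCol M a u) v i a≢b) (setCol-at M a u i)

  setCols-b : ∀ u v i → setCols u v i b ≡ v i
  setCols-b u v i = setCol-at (setCol M a u) b v i

  setCols-off : ∀ u v i {j} → j ≢ a → j ≢ b → setCols u v i j ≡ M i j
  setCols-off u v i j≢a j≢b = trans (setCol-off (setCol M a u) v i j≢b) (setCol-off M u i j≢a)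

  det-setCols : ∀ (X : Mat n) u v → (∀ i → X i a ≡ u i) → (∀ i → X i b ≡ v i) →
    (∀ i j → j ≢ a → j ≢ b → X i j ≡ M i j) → det n X ≡ det n (setCols u v)
  det-setCols X u v Xa Xb Xoff = det-cong n entry
    where
    entry : ∀ i j → X i j ≡ setCols u v i j
    entry i j with j ≟ a | j ≟ b
    ... | yes refl | _        = trans (Xa i) (sym (setCols-a u v i))
    ... | no _     | yes refl = trans (Xb i) (sym (setCols-b u v i))
    ... | no j≢a   | no j≢b   = trans (Xoff i j j≢a j≢b) (sym (setCols-off u v i j≢a j≢b))

  det-setCols-+ˡ : ∀ u u' v → det n (setCols (u +ᵥ u') v) ≡ det n (setCols u v) + det n (setCols u' v)
  det-setCols-+ˡ u u' v = det-additiveInCol n a offA offA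
    (λ i → trans (setCols-a (u +ᵥ u') v i) (sym (cong₂ _+_ (setCols-a u v i) (setCols-a u' v i))))
    where
    offA : ∀ {w w'} i j → j ≢ a → setCols w v i j ≡ setCols w' v i j
    offA {w} {w'} i j j≢a with j ≟ b
    ... | yes refl = trans (setCols-b w v i) (sym (setCols-b w' v i))
    ... | no j≢b   = trans (setCols-off w v i j≢a j≢b) (sym (setCols-off w' v i j≢a j≢b))

  det-setCols-+ʳ : ∀ u v v' → det n (setCols u (v +ᵥ v')) ≡ det n (setCols u v) + det n (setCols u v')
  det-setCols-+ʳ u v v' = det-additiveInCol n b offB offB
    (λ i → trans (setCols-b u (v +ᵥ v') i) (sym (cong₂ _+_ (setCols-b u v i) (setCols-b u v' i))))
    where
    offB : ∀ {w w'} i j → j ≢ b → setCols u w i j ≡ setCols u w' i j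
    offB {w} {w'} i j j≢b with j ≟ a
    ... | yes refl = trans (setCols-a u w i) (sym (setCols-a u w' i))
    ... | no j≢a   = trans (setCols-off u w i j≢a j≢b) (sym (setCols-off u w' i j≢a j≢b))

  det-swapCols : (∀ X → (∀ i → X i a ≡ X i b) → det n X ≡ + 0) →
    (S : Mat n) → (∀ i → S i a ≡ M i b) → (∀ i → S i b ≡ M i a) →
    (∀ i j → j ≢ a → j ≢ b → S i j ≡ M i j) → det n S ≡ - det n M
  det-swapCols alternating S Sa Sb Soff = begin
    det n S                 ≡⟨ det-setCols S v u Sa Sb Soff ⟩
    B v u                   ≡⟨ solve-for (B u v) (B v u) polarise ⟩
    - B u v                 ≡⟨ cong -_ (det-setCols M u v (λ _ → refl) (λ _ → refl) (λ _ _ _ _ → refl)) ⟨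
    - det n M               ∎
    where
    open ≡-Reasoning
    u v : ℤVec n
    u i = M i a
    v i = M i b
    B : ℤVec n → ℤVec n → ℤ
    B x y = det n (setCols x y)
    B-diag : ∀ x → B x x ≡ + 0
    B-diag x = alternating (setCols x x) (λ i → trans (setCols-a x x i) (sym (setCols-b x x i)))
    polarise : B u v + B v u ≡ + 0
    polarise = begin
      B u v + B v u                             ≡⟨ diagonals (B u u) (B u v) (B v u) (B v v) (B-diag u) (B-diag v) ⟨
      (B u u + B u v) + (B v u + B v v)         ≡⟨ cong₂ _+_ (det-setCols-+ʳ u u v) (det-setCols-+ʳ v u v) ⟨
      B u (u +ᵥ v) + B v (u +ᵥ v)               ≡⟨ det-setCols-+ˡ u v (u +ᵥ v) ⟨
      B (u +ᵥ v) (u +ᵥ v)                       ≡⟨ B-diag (u +ᵥ v) ⟩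
      + 0                                       ∎
      where
      diagonals : ∀ p q r s → p ≡ + 0 → s ≡ + 0 → (p + q) + (r + s) ≡ q + r
      diagonals p q r s refl refl = ring q r
        where
        ring : ∀ q r → (+ 0 + q) + (r + + 0) ≡ q + r
        ring = solve-∀
    solve-for : ∀ x y → x + y ≡ + 0 → y ≡ - x
    solve-for x y x+y≡0 = trans (ring x y) (trans (cong (_- x) x+y≡0) (ℤ.+-identityˡ (- x)))
      where
      ring : ∀ x y → y ≡ (x + y) - x
      ring = solve-∀

det-equalColsBelow : ∀ k n (M : Mat (suc n)) a (c : Fin n) → toℕ c ≡ k → toℕ a ℕ.≤ toℕ c →
  (∀ i → M i a ≡ M i (suc c)) → det (suc n) M ≡ + 0
det-equalColsBelow k n M a c c≡k a≤c cols≡ with a ≟ inject₁ c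
... | yes refl = det-equalAdjacentCols n M c cols≡
det-equalColsBelow k n M zero zero _ _ _ | no a≢c = ⊥-elim (a≢c refl)
det-equalColsBelow (suc k) (suc n) M a (suc c₀) c≡k a≤c cols≡ | no a≢c = begin
  det (suc (suc n)) M   ≡⟨ ℤ.neg-involutive _ ⟨
  - - det (suc (suc n)) M ≡⟨ cong -_ swapped ⟨
  - det (suc (suc n)) S ≡⟨ cong -_ S-singular ⟩
  - + 0                 ∎
  where
  open ≡-Reasoning
  c = suc c₀
  open TwoColumns M (inject₁≢suc c)
  u v : ℤVec (suc (suc n))
  u i = M i (suc c)
  v i = M i (inject₁ c)
  S = setCols u v
  swapped : det (suc (suc n)) S ≡ - det (suc (suc n)) M
  swapped = det-swapCols (λ X → det-equalAdjacentCols (suc n) X c) S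
    (setCols-a u v) (setCols-b u v) (λ i j → setCols-off u v i)
  a≤c₀ : toℕ a ℕ.≤ toℕ c₀
  a≤c₀ = ℕ.s≤s⁻¹ (ℕ.≤∧≢⇒< a≤c (λ e → a≢c (toℕ-injective (trans e (sym (toℕ-inject₁ c))))))
  a≢c+1 : a ≢ suc c
  a≢c+1 e = ℕ.<⇒≢ (s≤s a≤c) (cong toℕ e)
  S-singular : det (suc (suc n)) S ≡ + 0
  S-singular = det-equalColsBelow k (suc n) S a (inject₁ c₀)
    (trans (toℕ-inject₁ c₀) (ℕ.suc-injective c≡k))
    (subst (toℕ a ℕ.≤_) (sym (toℕ-inject₁ c₀)) a≤c₀)
    (λ i → trans (setCols-off u v i a≢c a≢c+1) (trans (cols≡ i) (sym (setCols-a u v i))))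

det-equalCols : ∀ n (M : Mat n) {a b} → a ≢ b → (∀ i → M i a ≡ M i b) → det n M ≡ + 0
det-equalCols n M {a} {b} a≢b cols≡ with ℕ.<-cmp (toℕ a) (toℕ b)
... | tri≈ _ e _ = ⊥-elim (a≢b (toℕ-injective e))
det-equalCols (suc n) M {a} {suc c} a≢b cols≡ | tri< a<b _ _ =
  det-equalColsBelow (toℕ c) n M a c refl (ℕ.s≤s⁻¹ a<b) cols≡
det-equalCols (suc n) M {suc c} {b} a≢b cols≡ | tri> _ _ b<a =
  det-equalColsBelow (toℕ c) n M b c refl (ℕ.s≤s⁻¹ b<a) (sym ∘ cols≡)

det-addCol : ∀ n (M : Mat n) {j i} c → i ≢ j → det n (addCol M j i c) ≡ det n M
det-addCol n M {j} {i} c i≢j = begin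
  det n (addCol M j i c)                   ≡⟨ det-linearInCol n j (+ 1) c same same' col ⟩
  + 1 * det n M + c * det n (setCol M j colᵢ) ≡⟨ cong (λ d → + 1 * det n M + c * d) (det-equalCols n _ (i≢j ∘ sym) equal) ⟩
  + 1 * det n M + c * + 0                  ≡⟨ ring (det n M) c ⟩
  det n M                                  ∎
  where
  open ≡-Reasoning
  colᵢ : ℤVec n
  colᵢ r = M r i
  same : ∀ r l → l ≢ j → addCol M j i c r l ≡ M r l
  same r l l≢j = shear-off i c (M r) l≢j
  same' : ∀ r l → l ≢ j → addCol M j i c r l ≡ setCol M j colᵢ r l
  same' r l l≢j = trans (same r l l≢j) (sym (setCol-off M colᵢ r l≢j))
  col : ∀ r → addCol M j i c r j ≡ + 1 * M r j + c * setCol M j colᵢ r j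
  col r = trans (shear-at j i c (M r))
    (cong₂ (λ a b → a + c * b) (sym (ℤ.*-identityˡ (M r j))) (sym (setCol-at M j colᵢ r)))
  equal : ∀ r → setCol M j colᵢ r j ≡ setCol M j colᵢ r i
  equal r = trans (setCol-at M j colᵢ r) (sym (setCol-off M colᵢ r i≢j))
  ring : ∀ d c → + 1 * d + c * + 0 ≡ d
  ring = solve-∀

minorCol : ∀ {n} → Mat (suc n) → Fin (suc n) → Mat n
minorCol M i r l = M (punchIn i r) (suc l)

detByCol : (n : ℕ) → Mat n → ℤ
detByCol zero    M = + 1
detByCol (suc n) M = sumFin (suc n) (λ i → sign (toℕ i) * (M i zero * detByCol n (minorCol M i)))

det-transpose≡detByCol : ∀ n (M : Mat n) → det n (transpose M) ≡ detByCol n M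
det-transpose≡detByCol zero    M = refl
det-transpose≡detByCol (suc n) M = sumFin-cong (suc n) (λ j →
  cong (λ d → sign (toℕ j) * (M j zero * d)) (det-transpose≡detByCol n (minorCol M j)))

-- Expanding twice, along the first row and then the first column, or the other way round,
-- gives the same double sum over the minors deleting rows 0, i+1 and columns 0, j+1.
det≡detByCol-step : ∀ n → (∀ M → det n M ≡ detByCol n M) → (∀ M → det (suc n) M ≡ detByCol (suc n) M) →
  ∀ M → det (suc (suc n)) M ≡ detByCol (suc (suc n)) M
det≡detByCol-step n ih₀ ih₁ M =
  cong₂ _+_ (cong (λ d → sign 0 * (M zero zero * d)) (ih₁ (minor M zero))) rest
  where
  open ≡-Reasoning
  X : Fin (suc n) → Fin (suc n) → Mat n
  X i j r l = M (suc (punchIn i r)) (suc (punchIn j l))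
  pull : ∀ {m} x y (g : Fin m → ℤ) → x * (y * sumFin m g) ≡ sumFin m (λ i → x * (y * g i))
  pull {m} x y g = trans (cong (x *_) (*-distribˡ-sumFin m y g)) (*-distribˡ-sumFin m x _)
  reorder : ∀ s t a b d → - s * (a * (t * (b * d))) ≡ - t * (b * (s * (a * d)))
  reorder = solve-∀
  rowFirst colFirst : Fin (suc n) → Fin (suc n) → ℤ → ℤ
  rowFirst i j d = sign (suc (toℕ j)) * (M zero (suc j) * (sign (toℕ i) * (M (suc i) zero * d)))
  colFirst i j d = sign (suc (toℕ i)) * (M (suc i) zero * (sign (toℕ j) * (M zero (suc j) * d)))
  expandMinorByCol : ∀ j → sign (suc (toℕ j)) * (M zero (suc j) * det (suc n) (minor M (suc j)))
                         ≡ sumFin (suc n) (λ i → rowFirst i j (detByCol n (X i j)))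
  expandMinorByCol j = trans (cong (λ d → sign (suc (toℕ j)) * (M zero (suc j) * d)) (ih₁ (minor M (suc j))))
                             (pull (sign (suc (toℕ j))) (M zero (suc j)) (λ i → sign (toℕ i) * (M (suc i) zero * detByCol n (X i j))))
  expandMinorByRow : ∀ i → sign (suc (toℕ i)) * (M (suc i) zero * detByCol (suc n) (minorCol M (suc i)))
                         ≡ sumFin (suc n) (λ j → colFirst i j (det n (X i j)))
  expandMinorByRow i = trans (cong (λ d → sign (suc (toℕ i)) * (M (suc i) zero * d)) (sym (ih₁ (minorCol M (suc i)))))
                             (pull (sign (suc (toℕ i))) (M (suc i) zero) (λ j → sign (toℕ j) * (M zero (suc j) * det n (X i j))))
  rest : sumFin (suc n) (λ j → sign (suc (toℕ j)) * (M zero (suc j) * det (suc n) (minor M (suc j))))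
       ≡ sumFin (suc n) (λ i → sign (suc (toℕ i)) * (M (suc i) zero * detByCol (suc n) (minorCol M (suc i))))
  rest = begin
    sumFin (suc n) (λ j → sign (suc (toℕ j)) * (M zero (suc j) * det (suc n) (minor M (suc j))))
      ≡⟨ sumFin-cong (suc n) expandMinorByCol ⟩
    sumFin (suc n) (λ j → sumFin (suc n) (λ i → rowFirst i j (detByCol n (X i j))))
      ≡⟨ sumFin-comm (suc n) (suc n) (λ j i → rowFirst i j (detByCol n (X i j))) ⟩
    sumFin (suc n) (λ i → sumFin (suc n) (λ j → rowFirst i j (detByCol n (X i j))))
      ≡⟨ sumFin-cong (suc n) (λ i → sumFin-cong (suc n) (λ j →
           trans (reorder (sign (toℕ j)) (sign (toℕ i)) (M zero (suc j)) (M (suc i) zero) _)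
                 (cong (colFirst i j) (sym (ih₀ (X i j)))))) ⟩
    sumFin (suc n) (λ i → sumFin (suc n) (λ j → colFirst i j (det n (X i j))))
      ≡⟨ sumFin-cong (suc n) expandMinorByRow ⟨
    sumFin (suc n) (λ i → sign (suc (toℕ i)) * (M (suc i) zero * detByCol (suc n) (minorCol M (suc i)))) ∎

det≡detByCol : ∀ n → (∀ M → det n M ≡ detByCol n M) × (∀ M → det (suc n) M ≡ detByCol (suc n) M)
det≡detByCol zero    = (λ M → refl) , (λ M → refl)
det≡detByCol (suc n) with det≡detByCol n
... | ih₀ , ih₁ = ih₁ , det≡detByCol-step n ih₀ ih₁

det-transpose : ∀ n (M : Mat n) → det n (transpose M) ≡ det n M
det-transpose n M = trans (det-transpose≡detByCol n M) (sym (proj₁ (det≡detByCol n) M))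

det-addRow : ∀ n (M : Mat n) {j i} c → i ≢ j → det n (addRow M j i c) ≡ det n M
det-addRow n M c i≢j =
  trans (det-transpose n _) (trans (det-addCol n (transpose M) c i≢j) (det-transpose n M))

∣-sumFin : ∀ {g} n (f : Fin n → ℤ) → (∀ i → g ∣ f i) → g ∣ sumFin n f
∣-sumFin {g} zero f g∣f = divides (+ 0) (sym (ℤ.*-zeroˡ g))
∣-sumFin (suc n) f g∣f = ∣m∣n⇒∣m+n (g∣f zero) (∣-sumFin n (f ∘ suc) (g∣f ∘ suc))

det-divisible : ∀ n (M : Mat n) {g} → (∀ i j → g ∣ M i j) → g ℤ.^ n ∣ det n M
det-divisible zero    M g∣M = ∣-refl
det-divisible (suc n) M {g} g∣M = ∣-sumFin (suc n) (expansionTerm M) term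
  where
  term : ∀ j → g ℤ.^ suc n ∣ expansionTerm M j
  term j with g∣M zero j | det-divisible n (minor M j) (λ r l → g∣M (suc r) (punchIn j l))
  ... | divides q eq | divides q' eq' =
    ∣n⇒∣m*n (sign (toℕ j)) (divides (q * q') (trans (cong₂ _*_ eq eq') (ring q q' g (g ℤ.^ n))))
    where
    ring : ∀ q q' g G → (q * g) * (q' * G) ≡ (q * q') * (g * G)
    ring = solve-∀

∣i^n∣≡∣i∣^n : ∀ i n → ∣ i ℤ.^ n ∣ ≡ ∣ i ∣ ℕ.^ n
∣i^n∣≡∣i∣^n i zero    = refl
∣i^n∣≡∣i∣^n i (suc n) = trans (ℤ.abs-* i (i ℤ.^ n)) (cong (∣ i ∣ ℕ.*_) (∣i^n∣≡∣i∣^n i n))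

det-firstRowZero : ∀ n (M : Mat (suc n)) → (∀ j → M zero (suc j) ≡ + 0) →
  det (suc n) M ≡ M zero zero * det n (minor M zero)
det-firstRowZero n M row≡0 = begin
  sumFin (suc n) (expansionTerm M)                        ≡⟨ sumFin-single (suc n) _ zero vanishes ⟩
  + 1 * (M zero zero * det n (minor M zero))              ≡⟨ ℤ.*-identityˡ _ ⟩
  M zero zero * det n (minor M zero)                      ∎
  where
  open ≡-Reasoning
  vanishes : ∀ j → j ≢ zero → expansionTerm M j ≡ + 0
  vanishes zero    0≢0 = ⊥-elim (0≢0 refl)
  vanishes (suc j) _   = trans (cong (λ m → sign (toℕ (suc j)) * (m * det n (minor M (suc j)))) (row≡0 j))
                               (ring (sign (toℕ (suc j))) (det n (minor M (suc j))))
    where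
    ring : ∀ s d → s * (+ 0 * d) ≡ + 0
    ring = solve-∀

module _ {n} (M : Mat n) where

  ≈-reflexive : ∀ {u v} → u ≗ v → u ≈[ M ] v
  ≈-reflexive {u} {v} u≗v = const (+ 0) , λ i →
    trans (cong (_- v i) (u≗v i)) (trans (ℤ.+-inverseʳ (v i)) (sym (*ᵥ-zero M i)))

  ≈-refl : ∀ {u} → u ≈[ M ] u
  ≈-refl {u} = ≈-reflexive {u} {u} (λ _ → refl)

  ≈-sym : ∀ {u v} → u ≈[ M ] v → v ≈[ M ] u
  ≈-sym {u} {v} (x , u-v≡Mx) = -_ ∘ x , λ i →
    trans (ring (u i) (v i)) (trans (cong -_ (u-v≡Mx i)) (sym (*ᵥ-neg M x i)))
    where
    ring : ∀ a b → b - a ≡ - (a - b)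
    ring = solve-∀

  ≈-trans : ∀ {u v w} → u ≈[ M ] v → v ≈[ M ] w → u ≈[ M ] w
  ≈-trans {u} {v} {w} (x , u-v≡Mx) (y , v-w≡My) = x +ᵥ y , λ i →
    trans (ring (u i) (v i) (w i)) (trans (cong₂ _+_ (u-v≡Mx i) (v-w≡My i)) (sym (*ᵥ-+ᵥ M x y i)))
    where
    ring : ∀ a b c → a - c ≡ (a - b) + (b - c)
    ring = solve-∀

  ≈-+ᵥ : ∀ {u u' v v'} → u ≈[ M ] u' → v ≈[ M ] v' → (u +ᵥ v) ≈[ M ] (u' +ᵥ v')
  ≈-+ᵥ {u} {u'} {v} {v'} (x , u-u'≡Mx) (y , v-v'≡My) = x +ᵥ y , λ i →
    trans (ring (u i) (u' i) (v i) (v' i)) (trans (cong₂ _+_ (u-u'≡Mx i) (v-v'≡My i)) (sym (*ᵥ-+ᵥ M x y i)))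
    where
    ring : ∀ a b c d → (a + c) - (b + d) ≡ (a - b) + (c - d)
    ring = solve-∀

  quotientSetoid : Setoid 0ℓ 0ℓ
  quotientSetoid = record
    { Carrier = ℤVec n
    ; _≈_ = _≈[ M ]_
    ; isEquivalence = record
        { refl = λ {u} → ≈-refl {u} ; sym = λ {u} {v} → ≈-sym {u} {v} ; trans = λ {u} {v} {w} → ≈-trans {u} {v} {w} }
    }

record _≅_ {n n'} (M : Mat n) (M' : Mat n') : Set where
  field
    to        : ℤVec n → ℤVec n'
    from      : ℤVec n' → ℤVec n
    to-cong   : ∀ {u v} → u ≈[ M ] v → to u ≈[ M' ] to v
    from-cong : ∀ {u v} → u ≈[ M' ] v → from u ≈[ M ] from v
    from-to   : ∀ u → from (to u) ≈[ M ] u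
    to-from   : ∀ v → to (from v) ≈[ M' ] v
    to-+ᵥ     : ∀ u v → to (u +ᵥ v) ≈[ M' ] (to u +ᵥ to v)

≅-refl : ∀ {n} {M : Mat n} → M ≅ M
≅-refl {M = M} = record
  { to = λ u → u ; from = λ v → v ; to-cong = λ e → e ; from-cong = λ e → e
  ; from-to = λ u → ≈-refl M {u} ; to-from = λ v → ≈-refl M {v} ; to-+ᵥ = λ u v → ≈-refl M {u +ᵥ v} }

≅-trans : ∀ {n n' n''} {M : Mat n} {M' : Mat n'} {M'' : Mat n''} → M ≅ M' → M' ≅ M'' → M ≅ M''
≅-trans {M = M} {M'} {M''} F G = record
  { to        = G.to ∘ F.to
  ; from      = F.from ∘ G.from
  ; to-cong   = G.to-cong ∘ F.to-cong
  ; from-cong = F.from-cong ∘ G.from-cong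
  ; from-to   = λ u → begin⟨ quotientSetoid M ⟩
      F.from (G.from (G.to (F.to u))) ≈⟨ F.from-cong (G.from-to (F.to u)) ⟩
      F.from (F.to u)                 ≈⟨ F.from-to u ⟩
      u                               ∎
  ; to-from   = λ v → begin⟨ quotientSetoid M'' ⟩
      G.to (F.to (F.from (G.from v))) ≈⟨ G.to-cong (F.to-from (G.from v)) ⟩
      G.to (G.from v)                 ≈⟨ G.to-from v ⟩
      v                               ∎
  ; to-+ᵥ     = λ u v → begin⟨ quotientSetoid M'' ⟩
      G.to (F.to (u +ᵥ v))            ≈⟨ G.to-cong (F.to-+ᵥ u v) ⟩
      G.to (F.to u +ᵥ F.to v)         ≈⟨ G.to-+ᵥ (F.to u) (F.to v) ⟩
      G.to (F.to u) +ᵥ G.to (F.to v)  ∎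
  }
  where
  module F = _≅_ F
  module G = _≅_ G
  open MultiSetoid

image : ∀ {n n'} {M : Mat n} {M' : Mat n'} → M ≅ M' → Subset n → Subset n'
image {M' = M'} F A b = ∃ λ a → A a × b ≈[ M' ] _≅_.to F a

≅⇒Iso : ∀ {n n'} {M : Mat n} {M' : Mat n'} (F : M ≅ M') (A : Subset n) → Iso M A M' (image F A)
≅⇒Iso {M = M} {M'} F A = record
  { to = to ; from = from ; to-cong = to-cong ; from-cong = from-cong ; from-to = from-to ; to-from = to-from
  ; arc-to   = λ u v → λ { (a , a∈A , v≈u+a) →
      to a , (a , a∈A , ≈-refl M' {to a}) , ≈-trans M' {to v} {to (u +ᵥ a)} (to-cong v≈u+a) (to-+ᵥ u a) }
  ; arc-from = λ u v → λ { (a' , (a , a∈A , a'≈a) , tv≈tu+a') → a , a∈A , (begin⟨ quotientSetoid M ⟩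
      v                     ≈⟨ from-to v ⟨
      from (to v)           ≈⟨ from-cong tv≈tu+a' ⟩
      from (to u +ᵥ a')     ≈⟨ from-cong (≈-+ᵥ M' {to u} {to u} (≈-refl M' {to u}) a'≈a) ⟩
      from (to u +ᵥ to a)   ≈⟨ from-cong (to-+ᵥ u a) ⟨
      from (to (u +ᵥ a))    ≈⟨ from-to (u +ᵥ a) ⟩
      u +ᵥ a                ∎) }
  }
  where
  open _≅_ F
  open MultiSetoid

addCol-≅ : ∀ {n} (M : Mat n) {j i} c → i ≢ j → M ≅ addCol M j i c
addCol-≅ M {j} {i} c i≢j = record
  { to = λ u → u ; from = λ v → v
  ; to-cong   = λ { (x , u-v≡Mx) → shear i j (- c) x , λ r → begin
      _                                      ≡⟨ u-v≡Mx r ⟩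
      (M *ᵥ x) r                             ≡⟨ *ᵥ-cong M (shear-inverse i j (- c) (i≢j ∘ sym) (ℤ.+-inverseˡ c) x) r ⟨
      (M *ᵥ shear i j c (shear i j (- c) x)) r ≡⟨ addCol-*ᵥ M j i c _ r ⟨
      (addCol M j i c *ᵥ shear i j (- c) x) r ∎ }
  ; from-cong = λ { (x , u-v≡M'x) → shear i j c x , λ r → trans (u-v≡M'x r) (addCol-*ᵥ M j i c x r) }
  ; from-to = λ u → ≈-refl M {u} ; to-from = λ v → ≈-refl (addCol M j i c) {v}
  ; to-+ᵥ = λ u v → ≈-refl (addCol M j i c) {u +ᵥ v}
  }
  where open ≡-Reasoning

addRow-≅ : ∀ {n} (M : Mat n) {j i} c → i ≢ j → M ≅ addRow M j i c
addRow-≅ M {j} {i} c i≢j = record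
  { to = shear j i c ; from = shear j i (- c)
  ; to-cong   = λ { {u} {v} (x , u-v≡Mx) → x , λ r → begin
      (shear j i c u -ᵥ shear j i c v) r ≡⟨ shear-minusᵥ j i c u v r ⟩
      shear j i c (u -ᵥ v) r             ≡⟨ shear-cong j i c u-v≡Mx r ⟩
      shear j i c (M *ᵥ x) r             ≡⟨ addRow-*ᵥ M j i c x r ⟨
      (addRow M j i c *ᵥ x) r            ∎ }
  ; from-cong = λ { {u} {v} (x , u-v≡M'x) → x , λ r → begin
      (shear j i (- c) u -ᵥ shear j i (- c) v) r ≡⟨ shear-minusᵥ j i (- c) u v r ⟩
      shear j i (- c) (u -ᵥ v) r                 ≡⟨ shear-cong j i (- c) (λ k → trans (u-v≡M'x k) (addRow-*ᵥ M j i c x k)) r ⟩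
      shear j i (- c) (shear j i c (M *ᵥ x)) r   ≡⟨ shear-inverse j i c i≢j (ℤ.+-inverseʳ c) (M *ᵥ x) r ⟩
      (M *ᵥ x) r                                 ∎ }
  ; from-to = λ u → ≈-reflexive M (shear-inverse j i c i≢j (ℤ.+-inverseʳ c) u)
  ; to-from = λ v → ≈-reflexive (addRow M j i c) (shear-inverse j i (- c) i≢j (ℤ.+-inverseˡ c) v)
  ; to-+ᵥ = λ u v → ≈-reflexive (addRow M j i c) (shear-+ᵥ j i c u v)
  }
  where open ≡-Reasoning

record _∼_ {n} (M M' : Mat n) : Set where
  field
    iso  : M ≅ M'
    det≡ : det n M' ≡ det n M

∼-refl : ∀ {n} {M : Mat n} → M ∼ M
∼-refl = record { iso = ≅-refl ; det≡ = refl }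

∼-trans : ∀ {n} {M M' M'' : Mat n} → M ∼ M' → M' ∼ M'' → M ∼ M''
∼-trans F G = record { iso = ≅-trans (_∼_.iso F) (_∼_.iso G) ; det≡ = trans (_∼_.det≡ G) (_∼_.det≡ F) }

addCol-∼ : ∀ {n} (M : Mat n) {j i} c → i ≢ j → M ∼ addCol M j i c
addCol-∼ {n} M c i≢j = record { iso = addCol-≅ M c i≢j ; det≡ = det-addCol n M c i≢j }

addRow-∼ : ∀ {n} (M : Mat n) {j i} c → i ≢ j → M ∼ addRow M j i c
addRow-∼ {n} M c i≢j = record { iso = addRow-≅ M c i≢j ; det≡ = det-addRow n M c i≢j }

module _ {n} (M : Mat (suc n)) {e} (e*e≡1 : e * e ≡ + 1) (pivot≡e : M zero zero ≡ e)
         (row≡0 : ∀ j → M zero (suc j) ≡ + 0) where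

  private
    M₁ : Mat n
    M₁ = minor M zero

    w : ℤVec n
    w i = M (suc i) zero

    *ᵥ-zero-row : ∀ x → (M *ᵥ x) zero ≡ e * x zero
    *ᵥ-zero-row x = begin
      M zero zero * x zero + sumFin n (λ j → M zero (suc j) * x (suc j))
        ≡⟨ cong₂ (λ p s → p * x zero + s) pivot≡e
                 (sumFin-zero n (λ j → trans (cong (_* x (suc j)) (row≡0 j)) (ℤ.*-zeroˡ (x (suc j))))) ⟩
      e * x zero + + 0 ≡⟨ ℤ.+-identityʳ _ ⟩
      e * x zero ∎
      where open ≡-Reasoning

    unit : ∀ z → e * (e * z) ≡ z
    unit z = trans (sym (ℤ.*-assoc e e z)) (trans (cong (_* z) e*e≡1) (ℤ.*-identityˡ z))

    -- u minus e u₀ times the first column of M, whose first coordinate vanishes as e² = 1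
    to : ℤVec (suc n) → ℤVec n
    to u i = u (suc i) - e * u zero * w i

    from : ℤVec n → ℤVec (suc n)
    from v = + 0 ∷ᵥ v

  ≅-dropUnitPivot : M ≅ M₁
  ≅-dropUnitPivot = record
    { to = to ; from = from
    ; to-cong = λ { {u} {v} (x , u-v≡Mx) → tail x , λ i → begin
        to u i - to v i
          ≡⟨ collect (u (suc i)) (v (suc i)) (u zero) (v zero) e (w i) ⟩
        (u (suc i) - v (suc i)) - e * (u zero - v zero) * w i
          ≡⟨ cong₂ (λ p q → p - e * q * w i) (u-v≡Mx (suc i)) (trans (u-v≡Mx zero) (*ᵥ-zero-row x)) ⟩
        (w i * x zero + (M₁ *ᵥ tail x) i) - e * (e * x zero) * w i
          ≡⟨ cong (λ z → (w i * x zero + (M₁ *ᵥ tail x) i) - z * w i) (unit (x zero)) ⟩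
        (w i * x zero + (M₁ *ᵥ tail x) i) - x zero * w i
          ≡⟨ cancel (w i) (x zero) ((M₁ *ᵥ tail x) i) ⟩
        (M₁ *ᵥ tail x) i ∎ }
    ; from-cong = λ { (y , u-v≡M₁y) → (+ 0 ∷ᵥ y) , λ
        { zero    → sym (trans (*ᵥ-zero-row (+ 0 ∷ᵥ y)) (ℤ.*-zeroʳ e))
        ; (suc i) → trans (u-v≡M₁y i) (sym (trans (cong (_+ (M₁ *ᵥ y) i) (ℤ.*-zeroʳ (w i))) (ℤ.+-identityˡ ((M₁ *ᵥ y) i)))) } }
    ; from-to = λ u → (- (e * u zero) ∷ᵥ const (+ 0)) , λ
        { zero    → sym (begin
            (M *ᵥ (- (e * u zero) ∷ᵥ const (+ 0))) zero ≡⟨ *ᵥ-zero-row (- (e * u zero) ∷ᵥ const (+ 0)) ⟩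
            e * - (e * u zero)                           ≡⟨ ℤ.neg-distribʳ-* e (e * u zero) ⟨
            - (e * (e * u zero))                         ≡⟨ cong -_ (unit (u zero)) ⟩
            - u zero                                     ≡⟨ ℤ.+-identityˡ _ ⟨
            + 0 - u zero                                 ∎)
        ; (suc i) → trans (shift (u (suc i)) e (u zero) (w i))
                          (cong (_+_ (w i * - (e * u zero))) (sym (*ᵥ-zero M₁ i))) }
    ; to-from = λ v → ≈-reflexive M₁ (λ i → vanish (v i) e (w i))
    ; to-+ᵥ = λ u v → ≈-reflexive M₁ (λ i → split (u (suc i)) (v (suc i)) (u zero) (v zero) e (w i))
    }
    where
    open ≡-Reasoning
    collect : ∀ a b c d e w → (a - e * c * w) - (b - e * d * w) ≡ (a - b) - e * (c - d) * w
    collect = solve-∀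
    cancel : ∀ w x m → (w * x + m) - x * w ≡ m
    cancel = solve-∀
    shift : ∀ a e u w → (a - e * u * w) - a ≡ w * - (e * u) + + 0
    shift = solve-∀
    vanish : ∀ v e w → v - e * + 0 * w ≡ v
    vanish = solve-∀
    split : ∀ a b c d e w → (a + b) - e * (c + d) * w ≡ (a - e * c * w) + (b - e * d * w)
    split = solve-∀

remainder-nonMultiple : ∀ {d x} → d ≢ + 0 → ¬ d ∣ x →
  ∃ λ r → ∃ λ q → x ≡ + r + q * d × r ≢ 0 × r ℕ.< ∣ d ∣
remainder-nonMultiple {d} {x} d≢0 d∤x =
  x % d , x / d , a≡a%n+[a/n]*n x d , (λ r≡0 → d∤x (divides (x / d) (multiple r≡0))) , n%d<d x d
  where
  instance _ = ≢-nonZero d≢0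
  multiple : x % d ≡ 0 → x ≡ (x / d) * d
  multiple r≡0 = trans (a≡a%n+[a/n]*n x d) (trans (cong (λ r → + r + (x / d) * d) r≡0) (ℤ.+-identityˡ _))

module LineReduction
  (line      : ∀ {n} → Mat (suc n) → Fin (suc n) → ℤ)
  (addLine   : ∀ {n} → Mat (suc n) → Fin (suc n) → Fin (suc n) → ℤ → Mat (suc n))
  (addLine-∼ : ∀ {n} (M : Mat (suc n)) {j i} c → i ≢ j → M ∼ addLine M j i c)
  (line-at   : ∀ {n} (M : Mat (suc n)) j i c → line (addLine M j i c) j ≡ line M j + c * line M i)
  (line-off  : ∀ {n} (M : Mat (suc n)) {j} i c {l} → l ≢ j → line (addLine M j i c) l ≡ line M l)
  where

  -- Four shears perform one step of the Euclidean algorithm on the entries at i and j: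
  -- (d, r + q d) ↦ (d, r) ↦ (d + r, r) ↦ (d + r, - d) ↦ (r, - d).
  euclidStep : ∀ {n} (M : Mat (suc n)) {i j} → i ≢ j → ∀ r q → line M j ≡ r + q * line M i →
    ∃ λ M' → M ∼ M' × line M' i ≡ r
  euclidStep M {i} {j} i≢j r q division =
    M₄ , ∼-trans (addLine-∼ M (- q) i≢j) (∼-trans (addLine-∼ M₁ (+ 1) j≢i)
           (∼-trans (addLine-∼ M₂ (- + 1) i≢j) (addLine-∼ M₃ (+ 1) j≢i))) , pivot
    where
    open ≡-Reasoning
    j≢i = i≢j ∘ sym
    M₁ = addLine M j i (- q)
    M₂ = addLine M₁ i j (+ 1)
    M₃ = addLine M₂ j i (- + 1)
    M₄ = addLine M₃ i j (+ 1)
    ring : ∀ a b → (a + + 1 * b) + + 1 * (b + - + 1 * (a + + 1 * b)) ≡ b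
    ring = solve-∀
    remainder : line M₁ j ≡ r
    remainder = begin
      line M₁ j                           ≡⟨ line-at M j i (- q) ⟩
      line M j + - q * line M i           ≡⟨ cong (_+ - q * line M i) division ⟩
      (r + q * line M i) + - q * line M i ≡⟨ cancel r q (line M i) ⟩
      r                                   ∎
      where
      cancel : ∀ r q d → (r + q * d) + - q * d ≡ r
      cancel = solve-∀
    pivot : line M₄ i ≡ r
    pivot = begin
      line M₄ i
        ≡⟨ line-at M₃ i j (+ 1) ⟩
      line M₃ i + + 1 * line M₃ j
        ≡⟨ cong₂ (λ a b → a + + 1 * b) (line-off M₂ i (- + 1) i≢j) (line-at M₂ j i (- + 1)) ⟩
      line M₂ i + + 1 * (line M₂ j + - + 1 * line M₂ i)
        ≡⟨ cong₂ (λ a b → a + + 1 * (b + - + 1 * a)) (line-at M₁ i j (+ 1)) (line-off M₁ j (+ 1) j≢i) ⟩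
      (line M₁ i + + 1 * line M₁ j) + + 1 * (line M₁ j + - + 1 * (line M₁ i + + 1 * line M₁ j))
        ≡⟨ ring (line M₁ i) (line M₁ j) ⟩
      line M₁ j
        ≡⟨ remainder ⟩
      r ∎

  shrinkPivot : ∀ {n} (M : Mat (suc n)) {i j} → line M i ≢ + 0 → ¬ line M i ∣ line M j →
    ∃ λ M' → M ∼ M' × line M' i ≢ + 0 × ∣ line M' i ∣ ℕ.< ∣ line M i ∣
  shrinkPivot M {i} {j} d≢0 d∤x
    with remainder-nonMultiple d≢0 d∤x
  ... | r , q , division , r≢0 , r<d
    with euclidStep M (λ { refl → d∤x ∣-refl }) (+ r) q division
  ... | M' , M∼M' , pivot≡r =
    M' , M∼M' , (λ e → r≢0 (cong ∣_∣ (trans (sym pivot≡r) e))) , subst (λ p → ∣ p ∣ ℕ.< ∣ line M i ∣) (sym pivot≡r) r<d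

module Columns = LineReduction (λ M l → M zero l) addCol addCol-∼
  (λ M j i c → shear-at j i c (M zero)) (λ M i c → shear-off i c (M zero))
module Rows = LineReduction (λ M l → M l zero) addRow addRow-∼
  (λ M j i c → shear-at j i c (λ r → M r zero)) (λ M i c → shear-off i c (λ r → M r zero))

SmallerPivot : ∀ {n} → Mat (suc n) → Set
SmallerPivot M = ∃ λ M' → M ∼ M' × M' zero zero ≢ + 0 × ∣ M' zero zero ∣ ℕ.< ∣ M zero zero ∣

-- If d divides the first row and column but not M i j, then adding row i (cleared in column 0)
-- to row 0 puts a non-multiple of d into the first row.
shrinkPivot-interior : ∀ {n} (M : Mat (suc n)) {i j} → M zero zero ≢ + 0 →
  M zero zero ∣ M zero j → M zero zero ∣ M i zero → ¬ M zero zero ∣ M i j → SmallerPivot M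
shrinkPivot-interior M {i} {j} d≢0 d∣M₀ⱼ (divides q Mᵢ₀≡qd) d∤Mᵢⱼ =
  lift (Columns.shrinkPivot R₂ {zero} {j} (λ e → d≢0 (trans (sym pivot₂) e))
                                        (d∤Mᵢⱼ ∘ d∣R₂₀ⱼ⇒d∣Mᵢⱼ ∘ subst (_∣ R₂ zero j) pivot₂))
  where
  open ≡-Reasoning
  d = M zero zero
  i≢0 : i ≢ zero
  i≢0 refl = d∤Mᵢⱼ d∣M₀ⱼ
  R₁ = addRow M i zero (- q)
  R₂ = addRow R₁ zero i (+ 1)
  R₂-first-row : ∀ l → R₂ zero l ≡ M zero l + + 1 * (M i l + - q * M zero l)
  R₂-first-row l = begin
    R₁ zero l + + 1 * R₁ i l
      ≡⟨ cong₂ (λ a b → a + + 1 * b) (shear-off zero (- q) (λ r → M r l) (i≢0 ∘ sym)) (shear-at i zero (- q) (λ r → M r l)) ⟩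
    M zero l + + 1 * (M i l + - q * M zero l) ∎
  pivot₂ : R₂ zero zero ≡ d
  pivot₂ = begin
    R₂ zero zero                    ≡⟨ R₂-first-row zero ⟩
    d + + 1 * (M i zero + - q * d)  ≡⟨ cong (λ m → d + + 1 * (m + - q * d)) Mᵢ₀≡qd ⟩
    d + + 1 * (q * d + - q * d)     ≡⟨ ring d q ⟩
    d                               ∎
    where
    ring : ∀ d q → d + + 1 * (q * d + - q * d) ≡ d
    ring = solve-∀
  d∣R₂₀ⱼ⇒d∣Mᵢⱼ : d ∣ R₂ zero j → d ∣ M i j
  d∣R₂₀ⱼ⇒d∣Mᵢⱼ d∣R₂₀ⱼ = ∣m+n∣n⇒∣m (∣m+n∣m⇒∣n d∣sum d∣M₀ⱼ) (∣n⇒∣m*n (- q) d∣M₀ⱼ)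
    where
    d∣sum : d ∣ M zero j + (M i j + - q * M zero j)
    d∣sum = subst (d ∣_) (trans (R₂-first-row j) (cong (_+_ (M zero j)) (ℤ.*-identityˡ _))) d∣R₂₀ⱼ
  lift : SmallerPivot R₂ → SmallerPivot M
  lift (M' , R₂∼M' , pivot'≢0 , smaller) =
    M' , ∼-trans (addRow-∼ M (- q) (i≢0 ∘ sym)) (∼-trans (addRow-∼ R₁ (+ 1) i≢0) R₂∼M') , pivot'≢0 ,
    subst (λ p → ∣ M' zero zero ∣ ℕ.< ∣ p ∣) pivot₂ smaller

shrinkOrDivides : ∀ {n} (M : Mat (suc n)) → M zero zero ≢ + 0 → SmallerPivot M ⊎ (∀ i j → M zero zero ∣ M i j)
shrinkOrDivides M d≢0 with all? (λ j → M zero zero ∣? M zero j)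
... | no ¬row = inj₁ (Columns.shrinkPivot M d≢0 (proj₂ (¬∀⟶∃¬ _ _ (λ j → M zero zero ∣? M zero j) ¬row)))
... | yes row with all? (λ i → M zero zero ∣? M i zero)
...   | no ¬col = inj₁ (Rows.shrinkPivot M d≢0 (proj₂ (¬∀⟶∃¬ _ _ (λ i → M zero zero ∣? M i zero) ¬col)))
...   | yes col with all? (λ i → all? (λ j → M zero zero ∣? M i j))
...     | yes all = inj₂ all
...     | no ¬all with ¬∀⟶∃¬ _ _ (λ i → all? (λ j → M zero zero ∣? M i j)) ¬all
...       | i , ¬rowᵢ with ¬∀⟶∃¬ _ _ (λ j → M zero zero ∣? M i j) ¬rowᵢ
...         | j , d∤Mᵢⱼ = inj₁ (shrinkPivot-interior M d≢0 (row j) (col i) d∤Mᵢⱼ)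

PivotDividesAll : ∀ {n} → Mat (suc n) → Set
PivotDividesAll M = ∃ λ M' → M ∼ M' × M' zero zero ≢ + 0 × (∀ i j → M' zero zero ∣ M' i j)

pivotDividesAll-acc : ∀ {n} (M : Mat (suc n)) → M zero zero ≢ + 0 → Acc ℕ._<_ ∣ M zero zero ∣ → PivotDividesAll M
pivotDividesAll-acc M d≢0 (acc rec) with shrinkOrDivides M d≢0
... | inj₂ dividesAll = M , ∼-refl , d≢0 , dividesAll
... | inj₁ (M' , M∼M' , d'≢0 , smaller) with pivotDividesAll-acc M' d'≢0 (rec smaller)
...   | M'' , M'∼M'' , result = M'' , ∼-trans M∼M' M'∼M'' , result

pivotDividesAll : ∀ {n} (M : Mat (suc n)) → M zero zero ≢ + 0 → PivotDividesAll M
pivotDividesAll M d≢0 = pivotDividesAll-acc M d≢0 (<-wellFounded _)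

pivotNonzero : ∀ {n} (M : Mat (suc n)) → det (suc n) M ≢ + 0 → ∃ λ M' → M ∼ M' × M' zero zero ≢ + 0
pivotNonzero {n} M det≢0 with M zero zero ℤ.≟ + 0
... | no pivot≢0 = M , ∼-refl , pivot≢0
... | yes pivot≡0 with all? (λ j → M zero j ℤ.≟ + 0)
...   | yes row≡0 = ⊥-elim (det≢0 (trans (det-firstRowZero n M (row≡0 ∘ suc))
                                        (trans (cong (_* det n (minor M zero)) pivot≡0) (ℤ.*-zeroˡ (det n (minor M zero))))))
...   | no ¬row≡0 with ¬∀⟶∃¬ _ _ (λ j → M zero j ℤ.≟ + 0) ¬row≡0
...     | j , Mⱼ≢0 = addCol M zero j (+ 1) , addCol-∼ M (+ 1) j≢0 , pivot'≢0
  where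
  j≢0 : j ≢ zero
  j≢0 refl = Mⱼ≢0 pivot≡0
  pivot'≢0 : addCol M zero j (+ 1) zero zero ≢ + 0
  pivot'≢0 e = Mⱼ≢0 (begin
    M zero j                             ≡⟨ ring (M zero zero) (M zero j) pivot≡0 ⟨
    M zero zero + + 1 * M zero j         ≡⟨ shear-at zero j (+ 1) (M zero) ⟨
    addCol M zero j (+ 1) zero zero      ≡⟨ e ⟩
    + 0                                  ∎)
    where
    open ≡-Reasoning
    ring : ∀ a b → a ≡ + 0 → a + + 1 * b ≡ b
    ring a b refl = trans (ℤ.+-identityˡ _) (ℤ.*-identityˡ b)

module _ {n} (M : Mat (suc n)) {e} (e*e≡1 : e * e ≡ + 1) (pivot≡e : M zero zero ≡ e) where

  ClearedOn : List (Fin n) → Set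
  ClearedOn js = ∃ λ M' → M ∼ M' × M' zero zero ≡ e × (∀ j → j ∈ js → M' zero (suc j) ≡ + 0)

  clearColumns : ∀ js → ClearedOn js
  clearColumns []       = M , ∼-refl , pivot≡e , λ _ ()
  clearColumns (j ∷ js) with clearColumns js
  ... | M' , M∼M' , pivot'≡e , cleared = M'' , ∼-trans M∼M' (addCol-∼ M' {suc j} {zero} c (λ ())) , pivot''≡e , cleared''
    where
    c = - (M' zero (suc j) * e)
    M'' = addCol M' (suc j) zero c
    pivot''≡e : M'' zero zero ≡ e
    pivot''≡e = trans (shear-off {j = suc j} zero c (M' zero) (λ ())) pivot'≡e
    clearedⱼ : M'' zero (suc j) ≡ + 0
    clearedⱼ = begin
      M'' zero (suc j)                                  ≡⟨ shear-at (suc j) zero c (M' zero) ⟩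
      M' zero (suc j) + - (M' zero (suc j) * e) * M' zero zero ≡⟨ cong (λ p → M' zero (suc j) + - (M' zero (suc j) * e) * p) pivot'≡e ⟩
      M' zero (suc j) + - (M' zero (suc j) * e) * e     ≡⟨ ring (M' zero (suc j)) e ⟩
      M' zero (suc j) * (+ 1 - e * e)                   ≡⟨ cong (λ s → M' zero (suc j) * (+ 1 - s)) e*e≡1 ⟩
      M' zero (suc j) * (+ 1 - + 1)                     ≡⟨ ℤ.*-zeroʳ (M' zero (suc j)) ⟩
      + 0                                               ∎
      where
      open ≡-Reasoning
      ring : ∀ x e → x + - (x * e) * e ≡ x * (+ 1 - e * e)
      ring = solve-∀
    cleared'' : ∀ k → k ∈ j ∷ js → M'' zero (suc k) ≡ + 0
    cleared'' k (here refl) = clearedⱼ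
    cleared'' k (there k∈js) with k ≟ j
    ... | yes refl = clearedⱼ
    ... | no k≢j   = trans (shear-off zero c (M' zero) (k≢j ∘ suc-injective)) (cleared k k∈js)

  clearFirstRow : ∃ λ M' → M ∼ M' × M' zero zero ≡ e × (∀ j → M' zero (suc j) ≡ + 0)
  clearFirstRow with clearColumns (allFin n)
  ... | M' , M∼M' , pivot'≡e , cleared = M' , M∼M' , pivot'≡e , λ j → cleared j (∈-allFin j)

∣i∣≡1⇒i*i≡1 : ∀ i → ∣ i ∣ ≡ 1 → i * i ≡ + 1
∣i∣≡1⇒i*i≡1 (+ 1)        refl = refl
∣i∣≡1⇒i*i≡1 ℤ.-[1+ 0 ] refl = refl

dropUnitPivot : ∀ {n} (M : Mat (suc n)) → ∣ M zero zero ∣ ≡ 1 →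
  ∃ λ (M' : Mat n) → M ≅ M' × ∣ det n M' ∣ ≡ ∣ det (suc n) M ∣
dropUnitPivot {n} M ∣pivot∣≡1 with clearFirstRow M (∣i∣≡1⇒i*i≡1 (M zero zero) ∣pivot∣≡1) refl
... | M₁ , M∼M₁ , pivot≡e , row≡0 =
  minor M₁ zero , ≅-trans (_∼_.iso M∼M₁) (≅-dropUnitPivot M₁ (∣i∣≡1⇒i*i≡1 (M zero zero) ∣pivot∣≡1) pivot≡e row≡0) , (begin
    ∣ det n (minor M₁ zero) ∣                    ≡⟨ ℕ.*-identityˡ _ ⟨
    1 ℕ.* ∣ det n (minor M₁ zero) ∣              ≡⟨ cong (ℕ._* ∣ det n (minor M₁ zero) ∣) (trans (sym ∣pivot∣≡1) (cong ∣_∣ (sym pivot≡e))) ⟩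
    ∣ M₁ zero zero ∣ ℕ.* ∣ det n (minor M₁ zero) ∣ ≡⟨ ℤ.abs-* (M₁ zero zero) _ ⟨
    ∣ M₁ zero zero * det n (minor M₁ zero) ∣    ≡⟨ cong ∣_∣ (det-firstRowZero n M₁ row≡0) ⟨
    ∣ det (suc n) M₁ ∣                           ≡⟨ cong ∣_∣ (_∼_.det≡ M∼M₁) ⟩
    ∣ det (suc n) M ∣                            ∎)
  where open ≡-Reasoning

record CommonDivisorForm {n} (M : Mat n) : Set where
  field
    size       : ℕ
    matrix     : Mat (suc size)
    iso        : M ≅ matrix
    ∣det∣≡     : ∣ det (suc size) matrix ∣ ≡ ∣ det n M ∣
    divisor    : ℤ
    nontrivial : 2 ℕ.≤ ∣ divisor ∣
    divisor∣   : ∀ i j → divisor ∣ matrix i j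

CommonDivisorForm-transport : ∀ {n n'} {M : Mat n} {M' : Mat n'} → M ≅ M' → ∣ det n' M' ∣ ≡ ∣ det n M ∣ →
  CommonDivisorForm M' → CommonDivisorForm M
CommonDivisorForm-transport M≅M' ∣det∣≡ F = record
  { size = size ; matrix = matrix ; iso = ≅-trans M≅M' iso ; ∣det∣≡ = trans ∣det∣≡' ∣det∣≡
  ; divisor = divisor ; nontrivial = nontrivial ; divisor∣ = divisor∣ }
  where open CommonDivisorForm F renaming (∣det∣≡ to ∣det∣≡')

2≤∣i∣⇒i≢0 : ∀ {i} → 2 ℕ.≤ ∣ i ∣ → i ≢ + 0
2≤∣i∣⇒i≢0 () refl

≢0∧≢1⇒2≤ : ∀ {m} → m ≢ 0 → m ≢ 1 → 2 ℕ.≤ m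
≢0∧≢1⇒2≤ {zero}          m≢0 _   = ⊥-elim (m≢0 refl)
≢0∧≢1⇒2≤ {suc zero}      _   m≢1 = ⊥-elim (m≢1 refl)
≢0∧≢1⇒2≤ {suc (suc m)}   _   _   = s≤s (s≤s z≤n)

commonDivisorForm : ∀ n (M : Mat (suc n)) → 2 ℕ.≤ ∣ det (suc n) M ∣ → CommonDivisorForm M
commonDivisorForm zero M 2≤∣det∣ = record
  { size = 0 ; matrix = M ; iso = ≅-refl ; ∣det∣≡ = refl ; divisor = M zero zero
  ; nontrivial = subst (λ d → 2 ℕ.≤ ∣ d ∣) (ring (M zero zero)) 2≤∣det∣
  ; divisor∣ = λ { zero zero → ∣-refl } }
  where
  ring : ∀ a → + 1 * (a * + 1) + + 0 ≡ a
  ring = solve-∀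
commonDivisorForm (suc n) M 2≤∣det∣ with pivotNonzero M (2≤∣i∣⇒i≢0 2≤∣det∣)
... | M₁ , M∼M₁ , pivot₁≢0 with pivotDividesAll M₁ pivot₁≢0
...   | M₂ , M₁∼M₂ , pivot₂≢0 , dividesAll with ∣ M₂ zero zero ∣ ℕ.≟ 1
...     | no ∣pivot₂∣≢1 = record
  { size = suc n ; matrix = M₂ ; iso = _∼_.iso (∼-trans M∼M₁ M₁∼M₂)
  ; ∣det∣≡ = cong ∣_∣ (_∼_.det≡ (∼-trans M∼M₁ M₁∼M₂)) ; divisor = M₂ zero zero
  ; nontrivial = ≢0∧≢1⇒2≤ (pivot₂≢0 ∘ ℤ.∣i∣≡0⇒i≡0) ∣pivot₂∣≢1 ; divisor∣ = dividesAll }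
...     | yes ∣pivot₂∣≡1 = recurse (dropUnitPivot M₂ ∣pivot₂∣≡1)
  where
  M∼M₂ = ∼-trans M∼M₁ M₁∼M₂
  recurse : (∃ λ (M₃ : Mat (suc n)) → M₂ ≅ M₃ × ∣ det (suc n) M₃ ∣ ≡ ∣ det (suc (suc n)) M₂ ∣) → CommonDivisorForm M
  recurse (M₃ , M₂≅M₃ , ∣det₃∣≡∣det₂∣) =
    CommonDivisorForm-transport (≅-trans (_∼_.iso M∼M₂) M₂≅M₃) ∣det₃∣≡∣det∣
      (commonDivisorForm n M₃ (subst (2 ℕ.≤_) (sym ∣det₃∣≡∣det∣) 2≤∣det∣))
    where
    ∣det₃∣≡∣det∣ : ∣ det (suc n) M₃ ∣ ≡ ∣ det (suc (suc n)) M ∣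
    ∣det₃∣≡∣det∣ = trans ∣det₃∣≡∣det₂∣ (cong ∣_∣ (_∼_.det≡ M∼M₂))

module _ {n} {M : Mat n} (form : CommonDivisorForm M) where

  open CommonDivisorForm form

  CommonDivisorForm-realisable : det n M ≢ + 0 → ∀ A → Realisable M A (suc size)
  CommonDivisorForm-realisable det≢0 A =
    matrix , (λ e → det≢0 (ℤ.∣i∣≡0⇒i≡0 (trans (sym ∣det∣≡) (cong ∣_∣ e)))) , image iso A , ≅⇒Iso iso A

  CommonDivisorForm-primePower∣det : ∃ λ p → Prime p × p ℕ.^ suc size ℕ.∣ ∣ det n M ∣
  CommonDivisorForm-primePower∣det with ∃prime∣ nontrivial
  ... | p , p-prime , p∣divisor = p , p-prime ,
    ℕ.∣-trans (^-monoˡ-∣ (suc size) p∣divisor)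
      (subst₂ ℕ._∣_ (∣i^n∣≡∣i∣^n divisor (suc size)) ∣det∣≡ (∣⇒∣ᵤ (det-divisible (suc size) matrix divisor∣)))

  CommonDivisorForm-dimension≤maxExponent : det n M ≢ + 0 → (F : PrimeFactorisation ∣ det n M ∣) →
    ∀ {A k} → HasDimension M A k → k ≤ maxExponent F
  CommonDivisorForm-dimension≤maxExponent det≢0 F {A} (_ , _ , minimal) =
    ℕ.≤-trans (minimal (suc size) (s≤s z≤n) (CommonDivisorForm-realisable det≢0 A))
              (size≤maxExponent CommonDivisorForm-primePower∣det)
    where
    size≤maxExponent : (∃ λ p → Prime p × p ℕ.^ suc size ℕ.∣ ∣ det n M ∣) → suc size ≤ maxExponent F
    size≤maxExponent (p , p-prime , p^[1+size]∣det) = prime^∣⇒≤maxExponent F p-prime (suc size) p^[1+size]∣det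

corollary3p4 : (n : ℕ) → 1 ≤ n → (M : Mat n) → Nonsingular n M → (A : Subset n)
    → 2 ≤ ∣ det n M ∣
    → (F : PrimeFactorisation ∣ det n M ∣) → (k : ℕ) → HasDimension M A k
    → k ≤ maxExponent F × (SquareFree ∣ det n M ∣ → IsCirculant M A)
corollary3p4 (suc n) _ M nonsingular A 2≤∣det∣ F k dimension = k≤maxExponent , squareFree⇒circulant
  where
  k≤maxExponent : k ≤ maxExponent F
  k≤maxExponent = CommonDivisorForm-dimension≤maxExponent (commonDivisorForm n M 2≤∣det∣) nonsingular F dimension
  squareFree⇒circulant : SquareFree ∣ det (suc n) M ∣ → IsCirculant M A
  squareFree⇒circulant squareFree = subst (HasDimension M A)
    (ℕ.≤-antisym (ℕ.≤-trans k≤maxExponent (squareFree⇒maxExponent≤1 F squareFree)) (proj₁ dimension))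
    dimension
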